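{- Let $a_n$ be the number of staircase diagrams on the path graph $A_n$ ($a_0=1$), $\overline a_n$ the number of fully supported ones, $A(t)=\sum_{n\ge0}a_nt^n$ and $\overline A(t)=\sum_{n\ge1}\overline a_nt^n$. Then $$A(t)=\frac{1+\overline A(t)}{1-t-t\overline A(t)}.$$
   Context: Path graph $A_n$: vertices $s_1,\dots,s_n$, $s_i\sim s_{i+1}$. A staircase diagram is a poset $(\mathcal D,\preceq)$ of nonempty subsets (blocks) of the vertex set $S$ (the empty diagram included) with: (1) each block connected, and if $B$ covers $B'$ then $B\cup B'$ connected; (2) $\mathcal D_s=\{B:s\in B\}$ a chain; (3) if $s\sim t$, $\mathcal D_s\cup\mathcal D_t$ a chain in which $\mathcal D_s,\mathcal D_t$ are saturated; (4) each $B$ is the minimum of some $\mathcal D_s$ and maximum of some $\mathcal D_{s'}$. Fully supported means $\bigcup_B B=S$. -}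

module Defs where

open import Level using (0ℓ)
open import Data.Nat using (ℕ; zero; suc)
open import Data.Fin using (Fin; toℕ)
open import Data.Fin.Subset using (Subset; _∈_; _∪_; Nonempty)
open import Data.Bool using (Bool; T)
open import Data.Integer using (ℤ; +_; _+_; _-_; _*_)
open import Data.List using (List; foldr; map; upTo)
open import Data.Product using (Σ; ∃; ∃-syntax; _×_; _,_; proj₁; proj₂)
open import Data.Sum using (_⊎_)
open import Relation.Binary.PropositionalEquality using (_≡_; _≢_; refl; sym; trans)
open import Relation.Binary.Bundles using (Setoid)
open import Relation.Binary.Structures using (IsEquivalence)

-- The path graph A_n: vertices s_1..s_n are Fin n (s_{i+1} ↔ index i),
-- s_i ∼ s_{i+1}.

Adj : ∀ {n} → Fin n → Fin n → Set
Adj s t = suc (toℕ s) ≡ toℕ t ⊎ suc (toℕ t) ≡ toℕ s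

data Walk {n} (B : Subset n) : Fin n → Fin n → Set where
  here : ∀ {i} → Walk B i i
  step : ∀ {i j k} → Adj i j → j ∈ B → Walk B j k → Walk B i k

Connected : ∀ {n} → Subset n → Set
Connected B = ∀ i j → i ∈ B → j ∈ B → Walk B i j

-- Raw data of a diagram: a set of blocks (subsets of S) and a relation ≼
-- on blocks.

record DiagramData (n : ℕ) : Set where
  field
    mem : Subset n → Bool
    ord : Subset n → Subset n → Bool

module _ {n : ℕ} (d : DiagramData n) where
  open DiagramData d

  Blk : Subset n → Set
  Blk B = T (mem B)

  _≼_ : Subset n → Subset n → Set
  B ≼ C = T (ord B C)

  Covers : Subset n → Subset n → Set
  Covers C B = Blk B × Blk C × B ≼ C × B ≢ C ×
    (∀ E → Blk E → B ≼ E → E ≼ C → E ≡ B ⊎ E ≡ C)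

  record IsStaircase : Set where
    field
      ord-dom   : ∀ B C → B ≼ C → Blk B × Blk C
      ≼-refl    : ∀ B → Blk B → B ≼ B
      ≼-antisym : ∀ B C → B ≼ C → C ≼ B → B ≡ C
      ≼-trans   : ∀ B C E → B ≼ C → C ≼ E → B ≼ E
      nonempty  : ∀ B → Blk B → Nonempty B
      connected : ∀ B → Blk B → Connected B
      cover-connected : ∀ B B' → Covers B B' → Connected (B ∪ B')
      chain : ∀ s B C → Blk B → Blk C → s ∈ B → s ∈ C → B ≼ C ⊎ C ≼ B
      -- (3) for s ∼ t, D_s ∪ D_t is a chain ...
      adj-chain : ∀ s t → Adj s t → ∀ B C → Blk B → Blk C →
        (s ∈ B ⊎ t ∈ B) → (s ∈ C ⊎ t ∈ C) → B ≼ C ⊎ C ≼ B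
      -- ... in which D_s is saturated (D_t by symmetry of Adj)
      adj-saturated : ∀ s t → Adj s t → ∀ B C E → Blk B → Blk C → Blk E →
        s ∈ B → s ∈ E → (s ∈ C ⊎ t ∈ C) → B ≼ C → C ≼ E → s ∈ C
      is-min : ∀ B → Blk B → ∃[ s ] (s ∈ B × (∀ C → Blk C → s ∈ C → B ≼ C))
      is-max : ∀ B → Blk B → ∃[ s ] (s ∈ B × (∀ C → Blk C → s ∈ C → C ≼ B))

  FullySupported : Set
  FullySupported = ∀ s → ∃[ B ] (Blk B × s ∈ B)

-- Setoids of staircase diagrams (equality = same blocks, same order;
-- proofs are ignored).

SameData : ∀ {n} {P : DiagramData n → Set} → Σ (DiagramData n) P → Σ (DiagramData n) P → Set
SameData (d , _) (e , _) =
  (∀ B → DiagramData.mem d B ≡ DiagramData.mem e B) ×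
  (∀ B C → DiagramData.ord d B C ≡ DiagramData.ord e B C)

sameData-isEquivalence : ∀ {n} {P : DiagramData n → Set} → IsEquivalence (SameData {n} {P})
sameData-isEquivalence = record
  { refl  = (λ _ → refl) , (λ _ _ → refl)
  ; sym   = λ (p , q) → (λ B → sym (p B)) , (λ B C → sym (q B C))
  ; trans = λ (p , q) (p' , q') → (λ B → trans (p B) (p' B)) , (λ B C → trans (q B C) (q' B C))
  }

DiagramSetoid : ℕ → (P : ∀ {n} → DiagramData n → Set) → Setoid 0ℓ 0ℓ
DiagramSetoid n P = record
  { Carrier = Σ (DiagramData n) P
  ; _≈_ = SameData
  ; isEquivalence = sameData-isEquivalence }

StaircaseDiagrams : ℕ → Setoid 0ℓ 0ℓ
StaircaseDiagrams n = DiagramSetoid n IsStaircase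

FullStaircaseDiagrams : ℕ → Setoid 0ℓ 0ℓ
FullStaircaseDiagrams n = DiagramSetoid n (λ d → IsStaircase d × FullySupported d)

Series : Set
Series = ℕ → ℤ

sumℤ : List ℤ → ℤ
sumℤ = foldr _+_ (+ 0)

_⊕_ : Series → Series → Series
(f ⊕ g) n = f n + g n

_⊖_ : Series → Series → Series
(f ⊖ g) n = f n - g n

_⊛_ : Series → Series → Series
(f ⊛ g) n = sumℤ (map (λ i → f i * g (n Data.Nat.∸ i)) (upTo (suc n)))

𝟙 : Series
𝟙 zero = + 1
𝟙 (suc _) = + 0

𝕥 : Series
𝕥 1 = + 1
𝕥 _ = + 0

genFun : (ℕ → ℕ) → Series
genFun a n = + a n

genFun₊ : (ℕ → ℕ) → Series
genFun₊ a zero = + 0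
genFun₊ a (suc n) = + a (suc n)

module Submission where

open import Defs
open import Data.Nat using (ℕ)
open import Data.Fin using (Fin)
open import Function.Bundles using (Inverse)
open import Relation.Binary.PropositionalEquality using (_≡_; setoid)

open import Level using (0ℓ)
open import Data.Nat using (zero; suc; _∸_; _≤_; _<_; z≤n; s≤s; s≤s⁻¹)
import Data.Nat.Properties as NP
open import Data.Fin as F using (toℕ; _↑ˡ_; _↑ʳ_; splitAt; join; fromℕ<)
import Data.Fin.Properties as FP
open import Data.Fin.Subset using (Subset; _∈_; _∪_; Nonempty)
open import Data.Fin.Subset.Properties using (x∈p∪q⁻; x∈p∪q⁺)
open import Data.Vec using (Vec; []; _∷_; _++_; replicate; lookup; take; drop; tail)
import Data.Vec.Properties as VP
open import Data.Bool as Bool using (Bool; true; false; T; _∧_; _∨_; if_then_else_)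
open import Data.Product using (Σ; ∃; ∃-syntax; _×_; _,_; proj₁; proj₂)
open import Data.Sum as Sum using (_⊎_; inj₁; inj₂; swap)
open import Data.Empty using (⊥; ⊥-elim)
open import Data.Unit using (tt)
open import Function using (_∘_)
open import Relation.Nullary using (¬_; Dec; yes; no)
open import Relation.Nullary.Decidable using (⌊_⌋; toWitness; fromWitness)
open import Relation.Binary.Bundles using (Setoid)
open import Relation.Binary.PropositionalEquality
  using (_≢_; refl; sym; trans; cong; cong₂; subst; subst₂; module ≡-Reasoning)

-- The identity A = (1 + Ā) / (1 - t - t Ā) is equivalent, coefficientwise, to
-- the recurrence  a₀ = 1,  a_m = ā_m + Σ_{p<m} a_p ā_{m-1-p}  (with ā₀ = 1).
-- Combinatorially: a staircase diagram on A_m is either fully supported, or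
-- has a last unsupported vertex p.  In the latter case no block contains p,
-- every block lies left or right of p (blocks are connected), and the order
-- never relates the two sides (a cover relation has connected union, so by
-- induction along covers no relation crosses the gap).  Restricting to both
-- sides is then a bijection onto (diagrams on A_p) × (fully supported
-- diagrams on A_{m-1-p}), with inverse given by gluing.

module PowerSeries where

  open import Data.Integer using (ℤ; +_; _+_; _-_; _*_)
  import Data.Integer.Properties as ZP
  open import Data.Integer.Tactic.RingSolver using (solve-∀)
  open import Data.List using (applyUpTo)
  open import Data.List.Properties using (map-upTo)

  Σ< : ℕ → (ℕ → ℤ) → ℤ
  Σ< n f = sumℤ (applyUpTo f n)

  ⊛-as-Σ< : ∀ f g n → (f ⊛ g) n ≡ Σ< (suc n) (λ i → f i * g (n ∸ i))
  ⊛-as-Σ< f g n = cong sumℤ (map-upTo (λ i → f i * g (n ∸ i)) (suc n))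

  Σ<-suc : ∀ n f → Σ< (suc n) f ≡ Σ< n f + f n
  Σ<-suc zero    f = trans (ZP.+-identityʳ (f 0)) (sym (ZP.+-identityˡ (f 0)))
  Σ<-suc (suc n) f = trans (cong (λ x → f 0 + x) (Σ<-suc n (f ∘ suc))) (sym (ZP.+-assoc (f 0) _ _))

  Σ<-cong : ∀ n {f g} → (∀ i → i < n → f i ≡ g i) → Σ< n f ≡ Σ< n g
  Σ<-cong zero    eq = refl
  Σ<-cong (suc n) {f} {g} eq = begin
    Σ< (suc n) f  ≡⟨ Σ<-suc n f ⟩
    Σ< n f + f n  ≡⟨ cong₂ _+_ (Σ<-cong n (λ i i<n → eq i (NP.m<n⇒m<1+n i<n))) (eq n NP.≤-refl) ⟩
    Σ< n g + g n  ≡⟨ Σ<-suc n g ⟨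
    Σ< (suc n) g  ∎
    where open ≡-Reasoning

  Σ<-zero : ∀ n {f} → (∀ i → i < n → f i ≡ + 0) → Σ< n f ≡ + 0
  Σ<-zero n eq = trans (Σ<-cong n eq) (zeros n)
    where
    zeros : ∀ n → Σ< n (λ _ → + 0) ≡ + 0
    zeros zero    = refl
    zeros (suc n) = trans (ZP.+-identityˡ _) (zeros n)

  Σ<-⊖ : ∀ n f g → Σ< n (λ i → f i - g i) ≡ Σ< n f - Σ< n g
  Σ<-⊖ zero    f g = refl
  Σ<-⊖ (suc n) f g = begin
    Σ< (suc n) (λ i → f i - g i)               ≡⟨ Σ<-suc n (λ i → f i - g i) ⟩
    Σ< n (λ i → f i - g i) + (f n - g n)       ≡⟨ cong (_+ (f n - g n)) (Σ<-⊖ n f g) ⟩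
    (Σ< n f - Σ< n g) + (f n - g n)           ≡⟨ regroup (Σ< n f) (Σ< n g) (f n) (g n) ⟩
    (Σ< n f + f n) - (Σ< n g + g n)           ≡⟨ cong₂ _-_ (Σ<-suc n f) (Σ<-suc n g) ⟨
    Σ< (suc n) f - Σ< (suc n) g               ∎
    where
    open ≡-Reasoning
    regroup : ∀ x y u v → (x - y) + (u - v) ≡ (x + u) - (y + v)
    regroup = solve-∀

  ⊛-congʳ : ∀ f {g h} → (∀ i → g i ≡ h i) → ∀ n → (f ⊛ g) n ≡ (f ⊛ h) n
  ⊛-congʳ f {g} {h} eq n = begin
    (f ⊛ g) n                               ≡⟨ ⊛-as-Σ< f g n ⟩
    Σ< (suc n) (λ i → f i * g (n ∸ i))      ≡⟨ Σ<-cong (suc n) (λ i _ → cong (f i *_) (eq (n ∸ i))) ⟩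
    Σ< (suc n) (λ i → f i * h (n ∸ i))      ≡⟨ ⊛-as-Σ< f h n ⟨
    (f ⊛ h) n                               ∎
    where open ≡-Reasoning

  ⊛-⊖ʳ : ∀ f g h n → (f ⊛ (g ⊖ h)) n ≡ (f ⊛ g) n - (f ⊛ h) n
  ⊛-⊖ʳ f g h n = begin
    (f ⊛ (g ⊖ h)) n                                               ≡⟨ ⊛-as-Σ< f (g ⊖ h) n ⟩
    Σ< (suc n) (λ i → f i * (g (n ∸ i) - h (n ∸ i)))               ≡⟨ Σ<-cong (suc n) (λ i _ → distrib (f i) (g (n ∸ i)) (h (n ∸ i))) ⟩
    Σ< (suc n) (λ i → f i * g (n ∸ i) - f i * h (n ∸ i))           ≡⟨ Σ<-⊖ (suc n) (λ i → f i * g (n ∸ i)) (λ i → f i * h (n ∸ i)) ⟩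
    Σ< (suc n) (λ i → f i * g (n ∸ i)) - Σ< (suc n) (λ i → f i * h (n ∸ i))
                                                                   ≡⟨ cong₂ _-_ (⊛-as-Σ< f g n) (⊛-as-Σ< f h n) ⟨
    (f ⊛ g) n - (f ⊛ h) n                                         ∎
    where
    open ≡-Reasoning
    distrib : ∀ x y z → x * (y - z) ≡ x * y - x * z
    distrib = solve-∀

  ⊛-identityʳ : ∀ f n → (f ⊛ 𝟙) n ≡ f n
  ⊛-identityʳ f n = begin
    (f ⊛ 𝟙) n                                              ≡⟨ ⊛-as-Σ< f 𝟙 n ⟩
    Σ< (suc n) (λ i → f i * 𝟙 (n ∸ i))                     ≡⟨ Σ<-suc n (λ i → f i * 𝟙 (n ∸ i)) ⟩
    Σ< n (λ i → f i * 𝟙 (n ∸ i)) + f n * 𝟙 (n ∸ n)          ≡⟨ cong₂ _+_ (Σ<-zero n off-diagonal) (cong (λ k → f n * 𝟙 k) (NP.n∸n≡0 n)) ⟩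
    + 0 + f n * + 1                                        ≡⟨ trans (ZP.+-identityˡ _) (ZP.*-identityʳ (f n)) ⟩
    f n                                                    ∎
    where
    open ≡-Reasoning
    off-diagonal : ∀ i → i < n → f i * 𝟙 (n ∸ i) ≡ + 0
    off-diagonal i (s≤s i<n) = trans (cong (λ k → f i * 𝟙 k) (NP.+-∸-assoc 1 i<n)) (ZP.*-zeroʳ (f i))

  𝕥⊛-suc : ∀ g k → (𝕥 ⊛ g) (suc k) ≡ g k
  𝕥⊛-suc g k = begin
    (𝕥 ⊛ g) (suc k)                                           ≡⟨ ⊛-as-Σ< 𝕥 g (suc k) ⟩
    + 0 + (+ 1 * g k + Σ< k (λ i → + 0 * g (k ∸ suc i)))       ≡⟨ cong (λ x → + 0 + (+ 1 * g k + x)) (Σ<-zero k (λ _ _ → refl)) ⟩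
    + 0 + (+ 1 * g k + + 0)                                   ≡⟨ trans (ZP.+-identityˡ _) (trans (ZP.+-identityʳ _) (ZP.*-identityˡ (g k))) ⟩
    g k                                                       ∎
    where open ≡-Reasoning

  ⊛-𝕥⊛-zero : ∀ f g → (f ⊛ (𝕥 ⊛ g)) 0 ≡ + 0
  ⊛-𝕥⊛-zero f g = trans (ZP.+-identityʳ _) (ZP.*-zeroʳ (f 0))

  ⊛-𝕥⊛-suc : ∀ f g m → (f ⊛ (𝕥 ⊛ g)) (suc m) ≡ (f ⊛ g) m
  ⊛-𝕥⊛-suc f g m = begin
    (f ⊛ (𝕥 ⊛ g)) (suc m)                                                   ≡⟨ ⊛-as-Σ< f (𝕥 ⊛ g) (suc m) ⟩
    Σ< (suc (suc m)) (λ i → f i * (𝕥 ⊛ g) (suc m ∸ i))                       ≡⟨ Σ<-suc (suc m) (λ i → f i * (𝕥 ⊛ g) (suc m ∸ i)) ⟩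
    Σ< (suc m) (λ i → f i * (𝕥 ⊛ g) (suc m ∸ i)) + f (suc m) * (𝕥 ⊛ g) (m ∸ m)
                                   ≡⟨ cong₂ _+_ (Σ<-cong (suc m) shifted) (cong (λ k → f (suc m) * (𝕥 ⊛ g) k) (NP.n∸n≡0 m)) ⟩
    Σ< (suc m) (λ i → f i * g (m ∸ i)) + f (suc m) * + 0                     ≡⟨ trans (cong (λ x → Σ< (suc m) (λ i → f i * g (m ∸ i)) + x) (ZP.*-zeroʳ (f (suc m)))) (ZP.+-identityʳ _) ⟩
    Σ< (suc m) (λ i → f i * g (m ∸ i))                                       ≡⟨ ⊛-as-Σ< f g m ⟨
    (f ⊛ g) m                                                               ∎
    where
    open ≡-Reasoning
    shifted : ∀ i → i < suc m → f i * (𝕥 ⊛ g) (suc m ∸ i) ≡ f i * g (m ∸ i)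
    shifted i (s≤s i≤m) = cong (f i *_) (trans (cong (𝕥 ⊛ g) (NP.+-∸-assoc 1 i≤m)) (𝕥⊛-suc g (m ∸ i)))

  positivePart : Series → Series
  positivePart f zero    = + 0
  positivePart f (suc n) = f (suc n)

  positivePart-genFun : ∀ a n → positivePart (genFun a) n ≡ genFun₊ a n
  positivePart-genFun a zero    = refl
  positivePart-genFun a (suc n) = refl

  recurrence⇒identity : ∀ F G → F 0 ≡ + 1 → (∀ m → F (suc m) ≡ G (suc m) + (F ⊛ G) m) →
                        ∀ n → (F ⊛ (𝟙 ⊖ (𝕥 ⊛ G))) n ≡ (𝟙 ⊕ positivePart G) n
  recurrence⇒identity F G F₀ rec n = trans (⊛-⊖ʳ F 𝟙 (𝕥 ⊛ G) n) (trans (cong (_- (F ⊛ (𝕥 ⊛ G)) n) (⊛-identityʳ F n)) (at n))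
    where
    at : ∀ n → F n - (F ⊛ (𝕥 ⊛ G)) n ≡ (𝟙 ⊕ positivePart G) n
    at zero    = cong₂ _-_ F₀ (⊛-𝕥⊛-zero F G)
    at (suc m) = begin
      F (suc m) - (F ⊛ (𝕥 ⊛ G)) (suc m)      ≡⟨ cong₂ _-_ (rec m) (⊛-𝕥⊛-suc F G m) ⟩
      (G (suc m) + (F ⊛ G) m) - (F ⊛ G) m    ≡⟨ cancel (G (suc m)) ((F ⊛ G) m) ⟩
      G (suc m)                              ≡⟨ ZP.+-identityˡ (G (suc m)) ⟨
      + 0 + G (suc m)                        ∎
      where
      open ≡-Reasoning
      cancel : ∀ x y → (x + y) - y ≡ x
      cancel = solve-∀

  denominator : ∀ ā → ā 0 ≡ 1 → ∀ n → ((𝟙 ⊖ 𝕥) ⊖ (𝕥 ⊛ genFun₊ ā)) n ≡ (𝟙 ⊖ (𝕥 ⊛ genFun ā)) n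
  denominator ā ā₀ zero          = refl
  denominator ā ā₀ (suc zero)    rewrite 𝕥⊛-suc (genFun ā) 0 | ā₀ = refl
  denominator ā ā₀ (suc (suc k)) rewrite 𝕥⊛-suc (genFun₊ ā) (suc k) | 𝕥⊛-suc (genFun ā) (suc k) = refl

module Cardinality where

  open import Data.Nat using (_+_; _*_)
  open import Data.Fin.Properties using (+↔⊎; *↔×; injective⇒≤)
  open import Function.Bundles using (Injection)
  open import Function.Properties.Inverse using (Inverse⇒Injection)
  import Function.Construct.Composition as Compose
  import Function.Construct.Symmetry as Symmetry
  open import Data.Sum.Relation.Binary.Pointwise using (⊎-setoid; Pointwise-≡↔≡)
  open import Data.Product.Relation.Binary.Pointwise.NonDependent using (×-setoid)
  import Data.Product.Relation.Binary.Pointwise.NonDependent as ×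
  open import Data.Sum.Function.Setoid using (_⊎-inverse_)
  open import Data.Product.Function.NonDependent.Setoid using (_×-inverse_)

  HasSize : Setoid 0ℓ 0ℓ → ℕ → Set
  HasSize S k = Inverse (setoid (Fin k)) S

  size-transport : ∀ {S T k} → HasSize S k → Inverse S T → HasSize T k
  size-transport = Compose.inverse

  size-unique : ∀ {S k l} → HasSize S k → HasSize S l → k ≡ l
  size-unique {k = k} {l} c d =
    NP.≤-antisym (injective⇒≤ (injective f)) (injective⇒≤ (injective (Symmetry.inverse f)))
    where
    f : Inverse (setoid (Fin k)) (setoid (Fin l))
    f = Compose.inverse c (Symmetry.inverse d)
    injective : ∀ {m n} (g : Inverse (setoid (Fin m)) (setoid (Fin n))) → ∀ {x y} → Inverse.to g x ≡ Inverse.to g y → x ≡ y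
    injective g = Injection.injective (Inverse⇒Injection g)

  size-⊎ : ∀ {S T k l} → HasSize S k → HasSize T l → HasSize (⊎-setoid S T) (k + l)
  size-⊎ {k = k} {l} c d =
    Compose.inverse (+↔⊎ {k} {l}) (Compose.inverse (Symmetry.inverse (Pointwise-≡↔≡ (Fin k) (Fin l))) (c ⊎-inverse d))

  size-× : ∀ {S T k l} → HasSize S k → HasSize T l → HasSize (×-setoid S T) (k * l)
  size-× {k = k} {l} c d =
    Compose.inverse (*↔× {k} {l}) (Compose.inverse (Symmetry.inverse ×.Pointwise-≡↔≡) (c ×-inverse d))

module Segments where

  open import Data.Nat using (_+_)

  InImage : ∀ {k m} → (Fin k → Fin m) → Subset m → Set
  InImage ι B = ∀ x → x ∈ B → ∃[ j ] ι j ≡ x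

  record Segment (k m : ℕ) : Set where
    field
      ι        : Fin k → Fin m
      offset   : ℕ
      toℕ-ι    : ∀ j → toℕ (ι j) ≡ offset + toℕ j
      img      : Subset k → Subset m
      pre      : Subset m → Subset k
      ∈-img    : ∀ {L j} → j ∈ L → ι j ∈ img L
      ∈-img⁻   : ∀ {L j} → ι j ∈ img L → j ∈ L
      img-in-range : ∀ {L x} → x ∈ img L → ∃[ j ] ι j ≡ x
      pre-img  : ∀ L → pre (img L) ≡ L
      img-pre  : ∀ B → InImage ι B → img (pre B) ≡ B
      img-∪    : ∀ L L' → img (L ∪ L') ≡ img L ∪ img L'

  module SegmentProperties {k m} (E : Segment k m) where
    open Segment E

    ι-injective : ∀ {a b} → ι a ≡ ι b → a ≡ b
    ι-injective {a} {b} h =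
      FP.toℕ-injective (NP.+-cancelˡ-≡ offset _ _ (trans (sym (toℕ-ι a)) (trans (cong toℕ h) (toℕ-ι b))))

    img-injective : ∀ {L L'} → img L ≡ img L' → L ≡ L'
    img-injective {L} {L'} h = trans (sym (pre-img L)) (trans (cong pre h) (pre-img L'))

    succ-ι : ∀ {a b} → suc (toℕ a) ≡ toℕ b → suc (toℕ (ι a)) ≡ toℕ (ι b)
    succ-ι {a} {b} h = begin
      suc (toℕ (ι a))             ≡⟨ cong suc (toℕ-ι a) ⟩
      suc (offset + toℕ a)        ≡⟨ NP.+-suc offset (toℕ a) ⟨
      offset + suc (toℕ a)        ≡⟨ cong (offset +_) h ⟩
      offset + toℕ b              ≡⟨ toℕ-ι b ⟨
      toℕ (ι b)                   ∎
      where
      open ≡-Reasoning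

    succ-ι⁻ : ∀ {a b} → suc (toℕ (ι a)) ≡ toℕ (ι b) → suc (toℕ a) ≡ toℕ b
    succ-ι⁻ {a} {b} h = NP.+-cancelˡ-≡ offset _ _ (begin
      offset + suc (toℕ a)        ≡⟨ NP.+-suc offset (toℕ a) ⟩
      suc (offset + toℕ a)        ≡⟨ cong suc (toℕ-ι a) ⟨
      suc (toℕ (ι a))             ≡⟨ h ⟩
      toℕ (ι b)                   ≡⟨ toℕ-ι b ⟩
      offset + toℕ b              ∎)
      where
      open ≡-Reasoning

    adj-ι : ∀ {a b} → Adj a b → Adj (ι a) (ι b)
    adj-ι = Sum.map succ-ι succ-ι

    adj-ι⁻ : ∀ {a b} → Adj (ι a) (ι b) → Adj a b
    adj-ι⁻ = Sum.map succ-ι⁻ succ-ι⁻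

    walk-ι : ∀ {L a b} → Walk L a b → Walk (img L) (ι a) (ι b)
    walk-ι here            = here
    walk-ι (step ad j∈ w)  = step (adj-ι ad) (∈-img j∈) (walk-ι w)

    walk-ι⁻ : ∀ {L x y} → Walk (img L) x y → ∀ a b → ι a ≡ x → ι b ≡ y → Walk L a b
    walk-ι⁻ here a b ha hb with ι-injective (trans ha (sym hb))
    ... | refl = here
    walk-ι⁻ (step ad j∈ w) a b refl hb with img-in-range j∈
    ... | j , refl = step (adj-ι⁻ ad) (∈-img⁻ j∈) (walk-ι⁻ w j b refl hb)

    connected-img : ∀ {L} → Connected L → Connected (img L)
    connected-img cL x y x∈ y∈ with img-in-range x∈ | img-in-range y∈
    ... | a , refl | b , refl = walk-ι (cL a b (∈-img⁻ x∈) (∈-img⁻ y∈))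

    connected-img⁻ : ∀ {L} → Connected (img L) → Connected L
    connected-img⁻ cL a b a∈ b∈ = walk-ι⁻ (cL (ι a) (ι b) (∈-img a∈) (∈-img b∈)) a b refl refl

    nonempty-img⁻ : ∀ {L} → Nonempty (img L) → Nonempty L
    nonempty-img⁻ (x , x∈) with img-in-range x∈
    ... | j , refl = j , ∈-img⁻ x∈

module Restriction where
  open Segments

  restrict : ∀ {k m} → Segment k m → DiagramData m → DiagramData k
  restrict E d = record
    { mem = λ L → DiagramData.mem d (Segment.img E L)
    ; ord = λ L L' → DiagramData.ord d (Segment.img E L) (Segment.img E L') }

  -- If the blocks inside the segment form an up-set of the order (so that a
  -- block covering a segment block is again in the segment), the restriction
  -- of a staircase diagram is a staircase diagram.
  restrict-staircase : ∀ {k m} (E : Segment k m) (d : DiagramData m) → IsStaircase d →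
    (∀ B C → _≼_ d B C → InImage (Segment.ι E) B → InImage (Segment.ι E) C) →
    IsStaircase (restrict E d)
  restrict-staircase E d S up-closed = record
    { ord-dom   = λ B C h → ord-dom (img B) (img C) h
    ; ≼-refl    = λ B b → ≼-refl (img B) b
    ; ≼-antisym = λ B C h h' → img-injective (≼-antisym (img B) (img C) h h')
    ; ≼-trans   = λ B C D h h' → ≼-trans (img B) (img C) (img D) h h'
    ; nonempty  = λ B b → nonempty-img⁻ (nonempty (img B) b)
    ; connected = λ B b → connected-img⁻ (connected (img B) b)
    ; cover-connected = cover-connected′
    ; chain     = λ s B C bB bC s∈B s∈C → chain (ι s) (img B) (img C) bB bC (∈-img s∈B) (∈-img s∈C)
    ; adj-chain = λ s t ad B C bB bC hB hC →
        adj-chain (ι s) (ι t) (adj-ι ad) (img B) (img C) bB bC (Sum.map ∈-img ∈-img hB) (Sum.map ∈-img ∈-img hC)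
    ; adj-saturated = λ s t ad B C D bB bC bD s∈B s∈D hC h1 h2 →
        ∈-img⁻ (adj-saturated (ι s) (ι t) (adj-ι ad) (img B) (img C) (img D) bB bC bD
                              (∈-img s∈B) (∈-img s∈D) (Sum.map ∈-img ∈-img hC) h1 h2)
    ; is-min = is-min′
    ; is-max = is-max′
    }
    where
    open Segment E
    open SegmentProperties E
    open IsStaircase S
    res : DiagramData _
    res = restrict E d

    -- a cover in the restriction is a cover in d, because everything between
    -- two segment blocks is a segment block
    cover-connected′ : ∀ B B' → Covers res B B' → Connected (B ∪ B')
    cover-connected′ B B' (bB' , bB , le , ne , between) =
      connected-img⁻ (subst Connected (sym (img-∪ B B')) (cover-connected (img B) (img B') cover))
      where
      between′ : ∀ X → Blk d X → _≼_ d (img B') X → _≼_ d X (img B) → X ≡ img B' ⊎ X ≡ img B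
      between′ X bX h1 h2 with img-pre X (up-closed (img B') X h1 (λ x → img-in-range))
      ... | eq rewrite sym eq = Sum.map (cong img) (cong img) (between (pre X) bX h1 h2)
      cover : Covers d (img B) (img B')
      cover = bB' , bB , le , (λ q → ne (img-injective q)) , between′

    is-min′ : ∀ B → Blk res B → ∃[ s ] (s ∈ B × (∀ C → Blk res C → s ∈ C → _≼_ res B C))
    is-min′ B b with is-min (img B) b
    ... | x , x∈ , least with img-in-range x∈
    ... | j , refl = j , ∈-img⁻ x∈ , λ C bC j∈ → least (img C) bC (∈-img j∈)

    is-max′ : ∀ B → Blk res B → ∃[ s ] (s ∈ B × (∀ C → Blk res C → s ∈ C → _≼_ res C B))
    is-max′ B b with is-max (img B) b
    ... | x , x∈ , greatest with img-in-range x∈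
    ... | j , refl = j , ∈-img⁻ x∈ , λ C bC j∈ → greatest (img C) bC (∈-img j∈)

module Booleans where

  T-∧-intro : ∀ {x y} → T x → T y → T (x ∧ y)
  T-∧-intro {true} _ t = t

  T-∧-elim : ∀ {x y} → T (x ∧ y) → T x × T y
  T-∧-elim {true} t = tt , t

  T-∨-introˡ : ∀ {x y} → T x → T (x ∨ y)
  T-∨-introˡ {true} t = tt

  T-∨-introʳ : ∀ {x y} → T y → T (x ∨ y)
  T-∨-introʳ {true}  t = tt
  T-∨-introʳ {false} t = t

  T-∨-elim : ∀ {x y} → T (x ∨ y) → T x ⊎ T y
  T-∨-elim {true}  t = inj₁ tt
  T-∨-elim {false} t = inj₂ t

  T-extensional : ∀ {a b} → (T a → T b) → (T b → T a) → a ≡ b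
  T-extensional {false} {false} f g = refl
  T-extensional {false} {true}  f g = ⊥-elim (g tt)
  T-extensional {true}  {false} f g = ⊥-elim (f tt)
  T-extensional {true}  {true}  f g = refl

module Join {k₁ k₂ m} (E1 : Segments.Segment k₁ m) (E2 : Segments.Segment k₂ m)
  (disjoint : ∀ a b → Segments.Segment.ι E1 a ≡ Segments.Segment.ι E2 b → ⊥)
  (nonadjacent : ∀ a b → Adj (Segments.Segment.ι E1 a) (Segments.Segment.ι E2 b) → ⊥) where
  open Segments
  open Booleans
  open Restriction
  open DiagramData using (mem; ord)
  open Segment E1 using () renaming (ι to ι₁; img to img₁; pre to pre₁; ∈-img to ∈-img₁; ∈-img⁻ to ∈-img₁⁻;
    img-in-range to img₁-in-range; pre-img to pre₁-img₁; img-pre to img₁-pre₁; img-∪ to img₁-∪)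
  open Segment E2 using () renaming (ι to ι₂; img to img₂; pre to pre₂; ∈-img to ∈-img₂; ∈-img⁻ to ∈-img₂⁻;
    img-in-range to img₂-in-range; pre-img to pre₂-img₂; img-pre to img₂-pre₂; img-∪ to img₂-∪)
  module L1 = SegmentProperties E1
  module L2 = SegmentProperties E2

  -- decide whether a vertex set lies in the first (second) segment
  inSeg₁ : Subset m → Bool
  inSeg₁ X = ⌊ VP.≡-dec Bool._≟_ X (img₁ (pre₁ X)) ⌋
  inSeg₂ : Subset m → Bool
  inSeg₂ X = ⌊ VP.≡-dec Bool._≟_ X (img₂ (pre₂ X)) ⌋

  inSeg₁-sound : ∀ {X} → T (inSeg₁ X) → X ≡ img₁ (pre₁ X)
  inSeg₁-sound t = toWitness t
  inSeg₂-sound : ∀ {X} → T (inSeg₂ X) → X ≡ img₂ (pre₂ X)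
  inSeg₂-sound t = toWitness t
  inSeg₁-img : ∀ L → T (inSeg₁ (img₁ L))
  inSeg₁-img L = fromWitness (cong img₁ (sym (pre₁-img₁ L)))
  inSeg₂-img : ∀ L → T (inSeg₂ (img₂ L))
  inSeg₂-img L = fromWitness (cong img₂ (sym (pre₂-img₂ L)))

  glue : DiagramData k₁ → DiagramData k₂ → DiagramData m
  glue d1 d2 = record
    { mem = λ X → (inSeg₁ X ∧ DiagramData.mem d1 (pre₁ X)) ∨ (inSeg₂ X ∧ DiagramData.mem d2 (pre₂ X))
    ; ord = λ X Y → (inSeg₁ X ∧ (inSeg₁ Y ∧ DiagramData.ord d1 (pre₁ X) (pre₁ Y))) ∨
                    (inSeg₂ X ∧ (inSeg₂ Y ∧ DiagramData.ord d2 (pre₂ X) (pre₂ Y))) }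

  img₁≢img₂ : ∀ {L R} → Nonempty L → img₁ L ≡ img₂ R → ⊥
  img₁≢img₂ {L} {R} (j , j∈) eq with img₂-in-range (subst (ι₁ j ∈_) eq (∈-img₁ j∈))
  ... | b , h = disjoint j b (sym h)

  img₁≢img₂′ : ∀ {L R} → Nonempty R → img₁ L ≡ img₂ R → ⊥
  img₁≢img₂′ {L} {R} (j , j∈) eq with img₁-in-range (subst (ι₂ j ∈_) (sym eq) (∈-img₂ j∈))
  ... | b , h = disjoint b j h

  module _ (d1 : DiagramData k₁) (d2 : DiagramData k₂) where
    G : DiagramData m
    G = glue d1 d2

    glue-block⁻ : ∀ X → Blk G X → (Σ _ λ L → X ≡ img₁ L × Blk d1 L) ⊎ (Σ _ λ R → X ≡ img₂ R × Blk d2 R)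
    glue-block⁻ X t with T-∨-elim t
    ... | inj₁ u = let (i , b) = T-∧-elim u in inj₁ (_ , inSeg₁-sound i , b)
    ... | inj₂ u = let (i , b) = T-∧-elim u in inj₂ (_ , inSeg₂-sound i , b)

    glue-block₁ : ∀ {L} → Blk d1 L → Blk G (img₁ L)
    glue-block₁ {L} b = T-∨-introˡ (T-∧-intro (inSeg₁-img L) (subst (λ Z → T (DiagramData.mem d1 Z)) (sym (pre₁-img₁ L)) b))
    glue-block₂ : ∀ {R} → Blk d2 R → Blk G (img₂ R)
    glue-block₂ {R} b = T-∨-introʳ {inSeg₁ (img₂ R) ∧ _} (T-∧-intro (inSeg₂-img R) (subst (λ Z → T (DiagramData.mem d2 Z)) (sym (pre₂-img₂ R)) b))

    glue-≼⁻ : ∀ X Y → _≼_ G X Y →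
      (Σ _ λ L → Σ _ λ L' → X ≡ img₁ L × Y ≡ img₁ L' × _≼_ d1 L L') ⊎
      (Σ _ λ R → Σ _ λ R' → X ≡ img₂ R × Y ≡ img₂ R' × _≼_ d2 R R')
    glue-≼⁻ X Y t with T-∨-elim t
    ... | inj₁ u = let (i , u') = T-∧-elim u in let (i' , b) = T-∧-elim u' in inj₁ (_ , _ , inSeg₁-sound i , inSeg₁-sound i' , b)
    ... | inj₂ u = let (i , u') = T-∧-elim u in let (i' , b) = T-∧-elim u' in inj₂ (_ , _ , inSeg₂-sound i , inSeg₂-sound i' , b)

    glue-≼₁ : ∀ {L L'} → _≼_ d1 L L' → _≼_ G (img₁ L) (img₁ L')
    glue-≼₁ {L} {L'} b = T-∨-introˡ (T-∧-intro (inSeg₁-img L) (T-∧-intro (inSeg₁-img L') (subst₂ (λ Z Z' → T (DiagramData.ord d1 Z Z')) (sym (pre₁-img₁ L)) (sym (pre₁-img₁ L')) b)))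
    glue-≼₂ : ∀ {R R'} → _≼_ d2 R R' → _≼_ G (img₂ R) (img₂ R')
    glue-≼₂ {R} {R'} b = T-∨-introʳ {inSeg₁ (img₂ R) ∧ _} (T-∧-intro (inSeg₂-img R) (T-∧-intro (inSeg₂-img R') (subst₂ (λ Z Z' → T (DiagramData.ord d2 Z Z')) (sym (pre₂-img₂ R)) (sym (pre₂-img₂ R')) b)))

    -- Gluing preserves the staircase axioms: vertices of blocks on different
    -- sides are neither equal nor adjacent, so no axiom relates blocks across
    -- sides, and each axiom reduces to the same axiom on one side.
    module _ (S1 : IsStaircase d1) (S2 : IsStaircase d2) where
      module S1 = IsStaircase S1
      module S2 = IsStaircase S2

      separated : ∀ {x y} → (x ≡ y ⊎ Adj x y ⊎ Adj y x) → ∃[ a ] ι₁ a ≡ x → ∃[ b ] ι₂ b ≡ y → ⊥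
      separated (inj₁ refl) (a , ha) (b , hb) = disjoint a b (trans ha (sym hb))
      separated (inj₂ (inj₁ ad)) (a , refl) (b , refl) = nonadjacent a b ad
      separated (inj₂ (inj₂ ad)) (a , refl) (b , refl) = nonadjacent a b (swap ad)

      equal-or-adjacent : ∀ {s t u v : Fin m} → Adj s t → (u ≡ s ⊎ u ≡ t) → (v ≡ s ⊎ v ≡ t) → (u ≡ v ⊎ Adj u v ⊎ Adj v u)
      equal-or-adjacent ad (inj₁ refl) (inj₁ refl) = inj₁ refl
      equal-or-adjacent ad (inj₁ refl) (inj₂ refl) = inj₂ (inj₁ ad)
      equal-or-adjacent ad (inj₂ refl) (inj₁ refl) = inj₂ (inj₂ ad)
      equal-or-adjacent ad (inj₂ refl) (inj₂ refl) = inj₁ refl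

      witness : ∀ {s t : Fin m} {X} → (s ∈ X ⊎ t ∈ X) → Σ (Fin m) λ u → (u ≡ s ⊎ u ≡ t) × u ∈ X
      witness {s} (inj₁ h) = s , inj₁ refl , h
      witness {_} {t} (inj₂ h) = t , inj₂ refl , h

      ord-dom : ∀ X Y → _≼_ G X Y → Blk G X × Blk G Y
      ord-dom X Y h with glue-≼⁻ X Y h
      ... | inj₁ (L , L' , refl , refl , le) = let (a , b) = S1.ord-dom L L' le in glue-block₁ a , glue-block₁ b
      ... | inj₂ (L , L' , refl , refl , le) = let (a , b) = S2.ord-dom L L' le in glue-block₂ a , glue-block₂ b

      ≼-refl′ : ∀ X → Blk G X → _≼_ G X X
      ≼-refl′ X b with glue-block⁻ X b
      ... | inj₁ (L , refl , bL) = glue-≼₁ (S1.≼-refl L bL)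
      ... | inj₂ (L , refl , bL) = glue-≼₂ (S2.≼-refl L bL)

      ≼-antisym′ : ∀ X Y → _≼_ G X Y → _≼_ G Y X → X ≡ Y
      ≼-antisym′ X Y h h' with glue-≼⁻ X Y h | glue-≼⁻ Y X h'
      ... | inj₁ (L , L' , refl , refl , le) | inj₁ (M , M' , eq , eq' , le') with L1.img-injective eq | L1.img-injective eq'
      ... | refl | refl = cong img₁ (S1.≼-antisym L L' le le')
      ≼-antisym′ X Y h h' | inj₂ (L , L' , refl , refl , le) | inj₂ (M , M' , eq , eq' , le') with L2.img-injective eq | L2.img-injective eq'
      ... | refl | refl = cong img₂ (S2.≼-antisym L L' le le')
      ≼-antisym′ X Y h h' | inj₁ (L , L' , refl , refl , le) | inj₂ (M , M' , eq , eq' , le') =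
        ⊥-elim (img₁≢img₂ (S1.nonempty L' (proj₂ (S1.ord-dom L L' le))) eq)
      ≼-antisym′ X Y h h' | inj₂ (L , L' , refl , refl , le) | inj₁ (M , M' , eq , eq' , le') =
        ⊥-elim (img₁≢img₂′ (S2.nonempty L' (proj₂ (S2.ord-dom L L' le))) (sym eq))

      ≼-trans′ : ∀ X Y Z → _≼_ G X Y → _≼_ G Y Z → _≼_ G X Z
      ≼-trans′ X Y Z h h' with glue-≼⁻ X Y h | glue-≼⁻ Y Z h'
      ... | inj₁ (L , L' , refl , refl , le) | inj₁ (M , M' , eq , refl , le') with L1.img-injective eq
      ... | refl = glue-≼₁ (S1.≼-trans L L' M' le le')
      ≼-trans′ X Y Z h h' | inj₂ (L , L' , refl , refl , le) | inj₂ (M , M' , eq , refl , le') with L2.img-injective eq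
      ... | refl = glue-≼₂ (S2.≼-trans L L' M' le le')
      ≼-trans′ X Y Z h h' | inj₁ (L , L' , refl , refl , le) | inj₂ (M , M' , eq , _ , le') =
        ⊥-elim (img₁≢img₂ (S1.nonempty L' (proj₂ (S1.ord-dom L L' le))) eq)
      ≼-trans′ X Y Z h h' | inj₂ (L , L' , refl , refl , le) | inj₁ (M , M' , eq , _ , le') =
        ⊥-elim (img₁≢img₂′ (S2.nonempty L' (proj₂ (S2.ord-dom L L' le))) (sym eq))

      nonempty : ∀ X → Blk G X → Nonempty X
      nonempty X b with glue-block⁻ X b
      ... | inj₁ (L , refl , bL) = let (j , j∈) = S1.nonempty L bL in ι₁ j , ∈-img₁ j∈
      ... | inj₂ (L , refl , bL) = let (j , j∈) = S2.nonempty L bL in ι₂ j , ∈-img₂ j∈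

      connected : ∀ X → Blk G X → Connected X
      connected X b with glue-block⁻ X b
      ... | inj₁ (L , refl , bL) = L1.connected-img (S1.connected L bL)
      ... | inj₂ (L , refl , bL) = L2.connected-img (S2.connected L bL)

      cover-connected : ∀ X X' → Covers G X X' → Connected (X ∪ X')
      cover-connected X X' (bX' , bX , le , ne , btw) with glue-≼⁻ X' X le
      ... | inj₁ (L' , L , refl , refl , le1) =
        subst Connected (img₁-∪ L L') (L1.connected-img (S1.cover-connected L L' cov))
        where
        cov : Covers d1 L L'
        cov = proj₁ (S1.ord-dom L' L le1) , proj₂ (S1.ord-dom L' L le1) , le1 , (λ q → ne (cong img₁ q)) ,
              λ Z bZ h1 h2 → Sum.map L1.img-injective L1.img-injective (btw (img₁ Z) (glue-block₁ bZ) (glue-≼₁ h1) (glue-≼₁ h2))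
      ... | inj₂ (L' , L , refl , refl , le1) =
        subst Connected (img₂-∪ L L') (L2.connected-img (S2.cover-connected L L' cov))
        where
        cov : Covers d2 L L'
        cov = proj₁ (S2.ord-dom L' L le1) , proj₂ (S2.ord-dom L' L le1) , le1 , (λ q → ne (cong img₂ q)) ,
              λ Z bZ h1 h2 → Sum.map L2.img-injective L2.img-injective (btw (img₂ Z) (glue-block₂ bZ) (glue-≼₂ h1) (glue-≼₂ h2))

      chain : ∀ s X Y → Blk G X → Blk G Y → s ∈ X → s ∈ Y → _≼_ G X Y ⊎ _≼_ G Y X
      chain s X Y bX bY sX sY with glue-block⁻ X bX | glue-block⁻ Y bY
      ... | inj₁ (L , refl , bL) | inj₁ (L' , refl , bL') with img₁-in-range sX
      ... | j , refl = Sum.map glue-≼₁ glue-≼₁ (S1.chain j L L' bL bL' (∈-img₁⁻ sX) (∈-img₁⁻ sY))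
      chain s X Y bX bY sX sY | inj₂ (L , refl , bL) | inj₂ (L' , refl , bL') with img₂-in-range sX
      ... | j , refl = Sum.map glue-≼₂ glue-≼₂ (S2.chain j L L' bL bL' (∈-img₂⁻ sX) (∈-img₂⁻ sY))
      chain s X Y bX bY sX sY | inj₁ (L , refl , bL) | inj₂ (L' , refl , bL') = ⊥-elim (separated (inj₁ refl) (img₁-in-range sX) (img₂-in-range sY))
      chain s X Y bX bY sX sY | inj₂ (L , refl , bL) | inj₁ (L' , refl , bL') = ⊥-elim (separated (inj₁ refl) (img₁-in-range sY) (img₂-in-range sX))

      adj-chain : ∀ s t → Adj s t → ∀ X Y → Blk G X → Blk G Y →
        (s ∈ X ⊎ t ∈ X) → (s ∈ Y ⊎ t ∈ Y) → _≼_ G X Y ⊎ _≼_ G Y X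
      adj-chain s t ad X Y bX bY hX hY with witness hX | witness hY | glue-block⁻ X bX | glue-block⁻ Y bY
      ... | u , ru , uX | v , rv , vY | inj₁ (L , refl , bL) | inj₂ (L' , refl , bL') = ⊥-elim (separated (equal-or-adjacent ad ru rv) (img₁-in-range uX) (img₂-in-range vY))
      ... | u , ru , uX | v , rv , vY | inj₂ (L , refl , bL) | inj₁ (L' , refl , bL') = ⊥-elim (separated (equal-or-adjacent ad rv ru) (img₁-in-range vY) (img₂-in-range uX))
      ... | u , ru , uX | v , rv , vY | inj₁ (L , refl , bL) | inj₁ (L' , refl , bL') with img₁-in-range uX | img₁-in-range vY | equal-or-adjacent ad ru rv
      ... | a , refl | b , refl | inj₁ eq = Sum.map glue-≼₁ glue-≼₁ (S1.chain a L L' bL bL' (∈-img₁⁻ uX) (subst (_∈ L') (sym (L1.ι-injective eq)) (∈-img₁⁻ vY)))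
      ... | a , refl | b , refl | inj₂ (inj₁ ad') = Sum.map glue-≼₁ glue-≼₁ (S1.adj-chain a b (L1.adj-ι⁻ ad') L L' bL bL' (inj₁ (∈-img₁⁻ uX)) (inj₂ (∈-img₁⁻ vY)))
      ... | a , refl | b , refl | inj₂ (inj₂ ad') = Sum.map glue-≼₁ glue-≼₁ (S1.adj-chain b a (L1.adj-ι⁻ ad') L L' bL bL' (inj₂ (∈-img₁⁻ uX)) (inj₁ (∈-img₁⁻ vY)))
      adj-chain s t ad X Y bX bY hX hY | u , ru , uX | v , rv , vY | inj₂ (L , refl , bL) | inj₂ (L' , refl , bL') with img₂-in-range uX | img₂-in-range vY | equal-or-adjacent ad ru rv
      ... | a , refl | b , refl | inj₁ eq = Sum.map glue-≼₂ glue-≼₂ (S2.chain a L L' bL bL' (∈-img₂⁻ uX) (subst (_∈ L') (sym (L2.ι-injective eq)) (∈-img₂⁻ vY)))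
      ... | a , refl | b , refl | inj₂ (inj₁ ad') = Sum.map glue-≼₂ glue-≼₂ (S2.adj-chain a b (L2.adj-ι⁻ ad') L L' bL bL' (inj₁ (∈-img₂⁻ uX)) (inj₂ (∈-img₂⁻ vY)))
      ... | a , refl | b , refl | inj₂ (inj₂ ad') = Sum.map glue-≼₂ glue-≼₂ (S2.adj-chain b a (L2.adj-ι⁻ ad') L L' bL bL' (inj₂ (∈-img₂⁻ uX)) (inj₁ (∈-img₂⁻ vY)))

      adj-saturated : ∀ s t → Adj s t → ∀ X Y Z → Blk G X → Blk G Y → Blk G Z →
        s ∈ X → s ∈ Z → (s ∈ Y ⊎ t ∈ Y) → _≼_ G X Y → _≼_ G Y Z → s ∈ Y
      adj-saturated s t ad X Y Z bX bY bZ sX sZ (inj₁ sY) h1 h2 = sY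
      adj-saturated s t ad X Y Z bX bY bZ sX sZ (inj₂ tY) h1 h2 with glue-≼⁻ X Y h1 | glue-≼⁻ Y Z h2
      ... | inj₁ (L , L' , refl , refl , le) | inj₁ (M , M' , eq , refl , le') with L1.img-injective eq | img₁-in-range sX | img₁-in-range tY
      ... | refl | a , refl | b , refl =
        ∈-img₁ (S1.adj-saturated a b (L1.adj-ι⁻ ad) L L' M' (proj₁ (S1.ord-dom L L' le)) (proj₂ (S1.ord-dom L L' le)) (proj₂ (S1.ord-dom L' M' le'))
               (∈-img₁⁻ sX) (∈-img₁⁻ sZ) (inj₂ (∈-img₁⁻ tY)) le le')
      adj-saturated s t ad X Y Z bX bY bZ sX sZ (inj₂ tY) h1 h2 | inj₂ (L , L' , refl , refl , le) | inj₂ (M , M' , eq , refl , le') with L2.img-injective eq | img₂-in-range sX | img₂-in-range tY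
      ... | refl | a , refl | b , refl =
        ∈-img₂ (S2.adj-saturated a b (L2.adj-ι⁻ ad) L L' M' (proj₁ (S2.ord-dom L L' le)) (proj₂ (S2.ord-dom L L' le)) (proj₂ (S2.ord-dom L' M' le'))
               (∈-img₂⁻ sX) (∈-img₂⁻ sZ) (inj₂ (∈-img₂⁻ tY)) le le')
      adj-saturated s t ad X Y Z bX bY bZ sX sZ (inj₂ tY) h1 h2 | inj₁ (L , L' , refl , refl , le) | inj₂ (M , M' , eq , _ , le') =
        ⊥-elim (img₁≢img₂ (S1.nonempty L' (proj₂ (S1.ord-dom L L' le))) eq)
      adj-saturated s t ad X Y Z bX bY bZ sX sZ (inj₂ tY) h1 h2 | inj₂ (L , L' , refl , refl , le) | inj₁ (M , M' , eq , _ , le') =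
        ⊥-elim (img₁≢img₂′ (S2.nonempty L' (proj₂ (S2.ord-dom L L' le))) (sym eq))

      -- an extremal vertex of a block on one side stays extremal: blocks
      -- containing it lie on the same side
      is-min : ∀ X → Blk G X → ∃[ s ] (s ∈ X × (∀ Y → Blk G Y → s ∈ Y → _≼_ G X Y))
      is-min X b with glue-block⁻ X b
      ... | inj₁ (L , refl , bL) = let (j , j∈ , f) = S1.is-min L bL in ι₁ j , ∈-img₁ j∈ , lift j f
        where
        lift : ∀ j → (∀ C → Blk d1 C → j ∈ C → _≼_ d1 L C) → ∀ Y → Blk G Y → ι₁ j ∈ Y → _≼_ G (img₁ L) Y
        lift j f Y bY jY with glue-block⁻ Y bY
        ... | inj₁ (L' , refl , bL') = glue-≼₁ (f L' bL' (∈-img₁⁻ jY))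
        ... | inj₂ (R , refl , _) = ⊥-elim (separated (inj₁ refl) (j , refl) (img₂-in-range jY))
      ... | inj₂ (L , refl , bL) = let (j , j∈ , f) = S2.is-min L bL in ι₂ j , ∈-img₂ j∈ , lift j f
        where
        lift : ∀ j → (∀ C → Blk d2 C → j ∈ C → _≼_ d2 L C) → ∀ Y → Blk G Y → ι₂ j ∈ Y → _≼_ G (img₂ L) Y
        lift j f Y bY jY with glue-block⁻ Y bY
        ... | inj₂ (L' , refl , bL') = glue-≼₂ (f L' bL' (∈-img₂⁻ jY))
        ... | inj₁ (R , refl , _) = ⊥-elim (separated (inj₁ refl) (img₁-in-range jY) (j , refl))

      is-max : ∀ X → Blk G X → ∃[ s ] (s ∈ X × (∀ Y → Blk G Y → s ∈ Y → _≼_ G Y X))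
      is-max X b with glue-block⁻ X b
      ... | inj₁ (L , refl , bL) = let (j , j∈ , f) = S1.is-max L bL in ι₁ j , ∈-img₁ j∈ , lift j f
        where
        lift : ∀ j → (∀ C → Blk d1 C → j ∈ C → _≼_ d1 C L) → ∀ Y → Blk G Y → ι₁ j ∈ Y → _≼_ G Y (img₁ L)
        lift j f Y bY jY with glue-block⁻ Y bY
        ... | inj₁ (L' , refl , bL') = glue-≼₁ (f L' bL' (∈-img₁⁻ jY))
        ... | inj₂ (R , refl , _) = ⊥-elim (separated (inj₁ refl) (j , refl) (img₂-in-range jY))
      ... | inj₂ (L , refl , bL) = let (j , j∈ , f) = S2.is-max L bL in ι₂ j , ∈-img₂ j∈ , lift j f
        where
        lift : ∀ j → (∀ C → Blk d2 C → j ∈ C → _≼_ d2 C L) → ∀ Y → Blk G Y → ι₂ j ∈ Y → _≼_ G Y (img₂ L)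
        lift j f Y bY jY with glue-block⁻ Y bY
        ... | inj₂ (L' , refl , bL') = glue-≼₂ (f L' bL' (∈-img₂⁻ jY))
        ... | inj₁ (R , refl , _) = ⊥-elim (separated (inj₁ refl) (img₁-in-range jY) (j , refl))

      glue-staircase : IsStaircase G
      glue-staircase = record
        { ord-dom = ord-dom ; ≼-refl = ≼-refl′ ; ≼-antisym = ≼-antisym′ ; ≼-trans = ≼-trans′
        ; nonempty = nonempty ; connected = connected ; cover-connected = cover-connected
        ; chain = chain ; adj-chain = adj-chain ; adj-saturated = adj-saturated
        ; is-min = is-min ; is-max = is-max }

  module _ (d1 : DiagramData k₁) (d2 : DiagramData k₂) (S1 : IsStaircase d1) (S2 : IsStaircase d2) where
    private
      glued : DiagramData m
      glued = glue d1 d2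
      module SS1 = IsStaircase S1
      module SS2 = IsStaircase S2

    restrict₁-glue-mem : ∀ L → mem glued (img₁ L) ≡ mem d1 L
    restrict₁-glue-mem L = T-extensional f (glue-block₁ d1 d2)
      where
      f : Blk glued (img₁ L) → Blk d1 L
      f b with glue-block⁻ d1 d2 (img₁ L) b
      ... | inj₁ (L' , eq , b') = subst (Blk d1) (sym (L1.img-injective eq)) b'
      ... | inj₂ (R , eq , b') = ⊥-elim (img₁≢img₂′ (SS2.nonempty R b') eq)

    restrict₁-glue-ord : ∀ L L' → ord glued (img₁ L) (img₁ L') ≡ ord d1 L L'
    restrict₁-glue-ord L L' = T-extensional f (glue-≼₁ d1 d2)
      where
      f : _≼_ glued (img₁ L) (img₁ L') → _≼_ d1 L L'
      f b with glue-≼⁻ d1 d2 (img₁ L) (img₁ L') b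
      ... | inj₁ (M , M' , eq , eq' , le) = subst₂ (_≼_ d1) (sym (L1.img-injective eq)) (sym (L1.img-injective eq')) le
      ... | inj₂ (R , R' , eq , eq' , le) = ⊥-elim (img₁≢img₂′ (SS2.nonempty R (proj₁ (SS2.ord-dom R R' le))) eq)

    restrict₂-glue-mem : ∀ L → mem glued (img₂ L) ≡ mem d2 L
    restrict₂-glue-mem L = T-extensional f (glue-block₂ d1 d2)
      where
      f : Blk glued (img₂ L) → Blk d2 L
      f b with glue-block⁻ d1 d2 (img₂ L) b
      ... | inj₂ (L' , eq , b') = subst (Blk d2) (sym (L2.img-injective eq)) b'
      ... | inj₁ (R , eq , b') = ⊥-elim (img₁≢img₂ (SS1.nonempty R b') (sym eq))

    restrict₂-glue-ord : ∀ L L' → ord glued (img₂ L) (img₂ L') ≡ ord d2 L L'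
    restrict₂-glue-ord L L' = T-extensional f (glue-≼₂ d1 d2)
      where
      f : _≼_ glued (img₂ L) (img₂ L') → _≼_ d2 L L'
      f b with glue-≼⁻ d1 d2 (img₂ L) (img₂ L') b
      ... | inj₂ (M , M' , eq , eq' , le) = subst₂ (_≼_ d2) (sym (L2.img-injective eq)) (sym (L2.img-injective eq')) le
      ... | inj₁ (R , R' , eq , eq' , le) = ⊥-elim (img₁≢img₂ (SS1.nonempty R (proj₁ (SS1.ord-dom R R' le))) (sym eq))

  module _ (D : DiagramData m) (S : IsStaircase D)
    (side : ∀ X → Blk D X → InImage ι₁ X ⊎ InImage ι₂ X)
    (up-closed₁ : ∀ X Y → _≼_ D X Y → InImage ι₁ X → InImage ι₁ Y)
    (up-closed₂ : ∀ X Y → _≼_ D X Y → InImage ι₂ X → InImage ι₂ Y) where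
    private
      reglued : DiagramData m
      reglued = glue (restrict E1 D) (restrict E2 D)
      module SS = IsStaircase S

    glue-restrict-mem : ∀ X → mem reglued X ≡ mem D X
    glue-restrict-mem X = T-extensional f g
      where
      f : Blk reglued X → Blk D X
      f b with glue-block⁻ (restrict E1 D) (restrict E2 D) X b
      ... | inj₁ (L , refl , b') = b'
      ... | inj₂ (L , refl , b') = b'
      g : Blk D X → Blk reglued X
      g b with side X b
      ... | inj₁ i = subst (Blk reglued) (img₁-pre₁ X i) (glue-block₁ (restrict E1 D) (restrict E2 D) (subst (Blk D) (sym (img₁-pre₁ X i)) b))
      ... | inj₂ i = subst (Blk reglued) (img₂-pre₂ X i) (glue-block₂ (restrict E1 D) (restrict E2 D) (subst (Blk D) (sym (img₂-pre₂ X i)) b))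

    glue-restrict-ord : ∀ X Y → ord reglued X Y ≡ ord D X Y
    glue-restrict-ord X Y = T-extensional f g
      where
      f : _≼_ reglued X Y → _≼_ D X Y
      f b with glue-≼⁻ (restrict E1 D) (restrict E2 D) X Y b
      ... | inj₁ (L , L' , refl , refl , le) = le
      ... | inj₂ (L , L' , refl , refl , le) = le
      g : _≼_ D X Y → _≼_ reglued X Y
      g b with side X (proj₁ (SS.ord-dom X Y b))
      ... | inj₁ i = subst₂ (_≼_ reglued) (img₁-pre₁ X i) (img₁-pre₁ Y (up-closed₁ X Y b i))
           (glue-≼₁ (restrict E1 D) (restrict E2 D) (subst₂ (_≼_ D) (sym (img₁-pre₁ X i)) (sym (img₁-pre₁ Y (up-closed₁ X Y b i))) b))
      ... | inj₂ i = subst₂ (_≼_ reglued) (img₂-pre₂ X i) (img₂-pre₂ Y (up-closed₂ X Y b i))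
           (glue-≼₂ (restrict E1 D) (restrict E2 D) (subst₂ (_≼_ D) (sym (img₂-pre₂ X i)) (sym (img₂-pre₂ Y (up-closed₂ X Y b i))) b))

  glue-cong-mem : ∀ {d1 d1' d2 d2'} → (∀ L → mem d1 L ≡ mem d1' L) → (∀ L → mem d2 L ≡ mem d2' L) →
    ∀ X → mem (glue d1 d2) X ≡ mem (glue d1' d2') X
  glue-cong-mem p q X = cong₂ (λ u v → (inSeg₁ X ∧ u) ∨ (inSeg₂ X ∧ v)) (p (pre₁ X)) (q (pre₂ X))

  glue-cong-ord : ∀ {d1 d1' d2 d2'} → (∀ L L' → ord d1 L L' ≡ ord d1' L L') → (∀ L L' → ord d2 L L' ≡ ord d2' L L') →
    ∀ X Y → ord (glue d1 d2) X Y ≡ ord (glue d1' d2') X Y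
  glue-cong-ord p q X Y = cong₂ (λ u v → (inSeg₁ X ∧ (inSeg₁ Y ∧ u)) ∨ (inSeg₂ X ∧ (inSeg₂ Y ∧ v))) (p (pre₁ X) (pre₁ Y)) (q (pre₂ X) (pre₂ Y))

-- Counting the subsets of Fin n that satisfy a boolean predicate; used as a
-- termination measure for order intervals.
module SubsetCount where
  open import Data.Nat using (_+_)

  count : ∀ n → (Subset n → Bool) → ℕ
  count zero    P = if P [] then 1 else 0
  count (suc n) P = count n (λ B → P (true ∷ B)) + count n (λ B → P (false ∷ B))

  count-mono : ∀ n (f g : Subset n → Bool) → (∀ B → T (f B) → T (g B)) → count n f ≤ count n g
  count-mono zero f g f⇒g with f [] | g [] | f⇒g []
  ... | false | _     | _ = z≤n
  ... | true  | true  | _ = s≤s z≤n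
  ... | true  | false | k = ⊥-elim (k tt)
  count-mono (suc n) f g f⇒g =
    NP.+-mono-≤ (count-mono n _ _ (λ B → f⇒g (true ∷ B))) (count-mono n _ _ (λ B → f⇒g (false ∷ B)))

  count-strict : ∀ n (f g : Subset n → Bool) → (∀ B → T (f B) → T (g B)) →
                 ∀ B₀ → T (g B₀) → ¬ T (f B₀) → count n f < count n g
  count-strict zero f g f⇒g [] gB fB with f [] | g []
  ... | true  | _     = ⊥-elim (fB tt)
  ... | false | true  = s≤s z≤n
  ... | false | false = ⊥-elim gB
  count-strict (suc n) f g f⇒g (true ∷ B₀) gB fB =
    NP.+-mono-<-≤ (count-strict n _ _ (λ B → f⇒g (true ∷ B)) B₀ gB fB) (count-mono n _ _ (λ B → f⇒g (false ∷ B)))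
  count-strict (suc n) f g f⇒g (false ∷ B₀) gB fB =
    NP.+-mono-≤-< (count-mono n _ _ (λ B → f⇒g (true ∷ B))) (count-strict n _ _ (λ B → f⇒g (false ∷ B)) B₀ gB fB)

-- Suppose every block of a staircase diagram is of
-- kind Q or of kind Q', and no Q-block and Q'-block can have a connected union.
-- Then no cover leads from a Q-block to a Q'-block (axiom (1)), and since every
-- relation X ≼ Y in a finite poset is a chain of covers, ≼ preserves Q.
module CoverChains {m} (D : DiagramData m) (S : IsStaircase D) (Q Q' : Subset m → Set)
  (side : ∀ X → Blk D X → Q X ⊎ Q' X)
  (disconnected : ∀ X Y → Blk D X → Blk D Y → Q X → Q' Y → Connected (Y ∪ X) → ⊥) where
  open SubsetCount
  open Booleans
  open DiagramData D
  open IsStaircase S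
  open import Data.Fin.Subset.Properties using (anySubset?)
  open import Relation.Nullary.Decidable using (T?; ¬?; _×-dec_)

  _≟_ : (X Y : Subset m) → Dec (X ≡ Y)
  _≟_ = VP.≡-dec Bool._≟_

  interval : Subset m → Subset m → Subset m → Bool
  interval X Y Z = ord X Z ∧ ord Z Y

  StrictlyBetween : Subset m → Subset m → Subset m → Set
  StrictlyBetween X Y Z = Blk D Z × _≼_ D X Z × _≼_ D Z Y × Z ≢ X × Z ≢ Y

  strictly-between? : ∀ X Y → Dec (∃ (StrictlyBetween X Y))
  strictly-between? X Y = anySubset? λ Z →
    T? (mem Z) ×-dec T? (ord X Z) ×-dec T? (ord Z Y) ×-dec ¬? (Z ≟ X) ×-dec ¬? (Z ≟ Y)

  shrinkˡ : ∀ {X Y Z} → StrictlyBetween X Y Z → count m (interval X Z) < count m (interval X Y)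
  shrinkˡ {X} {Y} {Z} (_ , X≼Z , Z≼Y , _ , Z≢Y) =
    count-strict m (interval X Z) (interval X Y)
      (λ W w → let (X≼W , W≼Z) = T-∧-elim w in T-∧-intro X≼W (≼-trans W Z Y W≼Z Z≼Y))
      Y (T-∧-intro (≼-trans X Z Y X≼Z Z≼Y) (≼-refl Y (proj₂ (ord-dom Z Y Z≼Y))))
      (λ w → Z≢Y (≼-antisym Z Y Z≼Y (proj₂ (T-∧-elim w))))

  shrinkʳ : ∀ {X Y Z} → StrictlyBetween X Y Z → count m (interval Z Y) < count m (interval X Y)
  shrinkʳ {X} {Y} {Z} (_ , X≼Z , Z≼Y , Z≢X , _) =
    count-strict m (interval Z Y) (interval X Y)
      (λ W w → let (Z≼W , W≼Y) = T-∧-elim w in T-∧-intro (≼-trans X Z W X≼Z Z≼W) W≼Y)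
      X (T-∧-intro (≼-refl X (proj₁ (ord-dom X Z X≼Z))) (≼-trans X Z Y X≼Z Z≼Y))
      (λ w → Z≢X (≼-antisym Z X (proj₁ (T-∧-elim w)) X≼Z))

  cover : ∀ {X Y} → _≼_ D X Y → X ≢ Y → ¬ ∃ (StrictlyBetween X Y) → Covers D Y X
  cover {X} {Y} X≼Y X≢Y empty = proj₁ (ord-dom X Y X≼Y) , proj₂ (ord-dom X Y X≼Y) , X≼Y , X≢Y , endpoint
    where
    endpoint : ∀ Z → Blk D Z → _≼_ D X Z → _≼_ D Z Y → Z ≡ X ⊎ Z ≡ Y
    endpoint Z bZ X≼Z Z≼Y with Z ≟ X | Z ≟ Y
    ... | yes Z≡X | _       = inj₁ Z≡X
    ... | no _    | yes Z≡Y = inj₂ Z≡Y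
    ... | no Z≢X  | no Z≢Y  = ⊥-elim (empty (Z , bZ , X≼Z , Z≼Y , Z≢X , Z≢Y))

  ≼-preserves : ∀ X Y → _≼_ D X Y → Q X → Q Y
  ≼-preserves X Y X≼Y = climb (suc (count m (interval X Y))) X Y (NP.n<1+n _) X≼Y
    where
    climb : ∀ fuel X Y → count m (interval X Y) < fuel → _≼_ D X Y → Q X → Q Y
    climb (suc fuel) X Y small X≼Y qX with X ≟ Y | strictly-between? X Y
    ... | yes refl | _ = qX
    ... | no _ | yes (Z , between) =
      climb fuel Z Y (NP.<-≤-trans (shrinkʳ between) (s≤s⁻¹ small)) (proj₁ (proj₂ (proj₂ between)))
        (climb fuel X Z (NP.<-≤-trans (shrinkˡ between) (s≤s⁻¹ small)) (proj₁ (proj₂ between)) qX)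
    ... | no X≢Y | no empty with side Y (proj₂ (ord-dom X Y X≼Y))
    ...   | inj₁ qY  = qY
    ...   | inj₂ q'Y = ⊥-elim (disconnected X Y (proj₁ (ord-dom X Y X≼Y)) (proj₂ (ord-dom X Y X≼Y)) qX q'Y
                                             (cover-connected Y X (cover X≼Y X≢Y empty)))
module PathSplit where
  open import Data.Nat using (_+_)
  open import Data.Fin.Subset.Properties using (∪-identityˡ)
  open Segments

  vec-ext : ∀ {A : Set} {n} (v w : Vec A n) → (∀ i → lookup v i ≡ lookup w i) → v ≡ w
  vec-ext v w h = trans (sym (VP.tabulate∘lookup v)) (trans (VP.tabulate-cong h) (VP.tabulate∘lookup w))

  ∈→look : ∀ {n} {x : Fin n} {B} → x ∈ B → lookup B x ≡ true
  ∈→look = VP.[]=⇒lookup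

  look→∈ : ∀ {n} {x : Fin n} {B} → lookup B x ≡ true → x ∈ B
  look→∈ {x = x} {B} = VP.lookup⇒[]= x B

  t≢f : true ≡ false → ⊥
  t≢f ()

  lookup-take : ∀ {A : Set} p {n} (B : Vec A (p + n)) j → lookup (take p B) j ≡ lookup B (j ↑ˡ n)
  lookup-take (suc p) (b ∷ B) F.zero    = refl
  lookup-take (suc p) (b ∷ B) (F.suc j) = lookup-take p B j

  lookup-drop : ∀ {A : Set} p {n} (B : Vec A (p + n)) k → lookup (drop p B) k ≡ lookup B (p ↑ʳ k)
  lookup-drop zero    B       k = refl
  lookup-drop (suc p) (b ∷ B) k = lookup-drop p B k

  lookup-tail : ∀ {A : Set} {n} (v : Vec A (suc n)) k → lookup (tail v) k ≡ lookup v (F.suc k)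
  lookup-tail (x ∷ v) k = refl

  module ThreeParts (p q : ℕ) where
    m : ℕ
    m = p + suc q

    data View : Fin m → Set where
      vL : ∀ j → View (j ↑ˡ suc q)
      vM : View (p ↑ʳ F.zero)
      vR : ∀ k → View (p ↑ʳ F.suc k)

    view : ∀ x → View x
    view x = subst View (FP.join-splitAt p (suc q) x) (view-join (splitAt p x))
      where
      view-join : ∀ s → View (join p (suc q) s)
      view-join (inj₁ j)         = vL j
      view-join (inj₂ F.zero)    = vM
      view-join (inj₂ (F.suc k)) = vR k

    ιL : Fin p → Fin m
    ιL j = j ↑ˡ suc q

    ιR : Fin q → Fin m
    ιR k = p ↑ʳ F.suc k

    mid : Fin m
    mid = p ↑ʳ F.zero

    toℕL : ∀ (j : Fin p) → toℕ (j ↑ˡ suc q) ≡ toℕ j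
    toℕL j = FP.toℕ-↑ˡ j (suc q)

    toℕR : ∀ (k : Fin (suc q)) → toℕ (p ↑ʳ k) ≡ p + toℕ k
    toℕR k = FP.toℕ-↑ʳ p k

    toℕιR : ∀ (k : Fin q) → toℕ (ιR k) ≡ suc p + toℕ k
    toℕιR k = trans (toℕR (F.suc k)) (NP.+-suc p (toℕ k))

    toℕ-mid : toℕ mid ≡ p
    toℕ-mid = trans (toℕR F.zero) (NP.+-identityʳ p)

    left<p : ∀ j → toℕ (ιL j) < p
    left<p j = subst (_< p) (sym (toℕL j)) (FP.toℕ<n j)

    p<right : ∀ k → p < toℕ (ιR k)
    p<right k = subst (suc p ≤_) (sym (toℕιR k)) (NP.m≤m+n (suc p) (toℕ k))

    L≢R : ∀ (j : Fin p) (k : Fin (suc q)) → j ↑ˡ suc q ≡ p ↑ʳ k → ⊥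
    L≢R j k eq = NP.<⇒≱ (left<p j) (begin
      p                  ≤⟨ NP.m≤m+n p (toℕ k) ⟩
      p + toℕ k          ≡⟨ toℕR k ⟨
      toℕ (p ↑ʳ k)       ≡⟨ cong toℕ eq ⟨
      toℕ (ιL j)         ∎)
      where open NP.≤-Reasoning

    R0≢R : ∀ (k : Fin q) → p ↑ʳ F.zero ≡ p ↑ʳ F.suc k → ⊥
    R0≢R k eq with FP.↑ʳ-injective p F.zero (F.suc k) eq
    ... | ()

    L-R-disjoint : ∀ a b → ιL a ≡ ιR b → ⊥
    L-R-disjoint a b = L≢R a (F.suc b)

    L-R-nonadjacent : ∀ a b → Adj (ιL a) (ιR b) → ⊥
    L-R-nonadjacent a b (inj₁ e) = NP.<⇒≱ (left<p a) (s≤s⁻¹ (subst (suc p ≤_) (sym e) (p<right b)))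
    L-R-nonadjacent a b (inj₂ e) = NP.<-asym (left<p a) (NP.<-trans (p<right b) (subst (toℕ (ιR b) <_) e (NP.n<1+n _)))

    eL : Subset p → Subset m
    eL L = L ++ replicate (suc q) false
    preL : Subset m → Subset p
    preL B = take p B

    eR : Subset q → Subset m
    eR R = replicate p false ++ (false ∷ R)
    preR : Subset m → Subset q
    preR B = tail (drop p B)

    lookL-L : ∀ L (j : Fin p) → lookup (eL L) (j ↑ˡ suc q) ≡ lookup L j
    lookL-L L j = VP.lookup-++ˡ L _ j
    lookL-R : ∀ L (k : Fin (suc q)) → lookup (eL L) (p ↑ʳ k) ≡ false
    lookL-R L k = trans (VP.lookup-++ʳ L _ k) (VP.lookup-replicate k false)
    lookR-L : ∀ R (j : Fin p) → lookup (eR R) (j ↑ˡ suc q) ≡ false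
    lookR-L R j = trans (VP.lookup-++ˡ (replicate p false) _ j) (VP.lookup-replicate j false)
    lookR-M : ∀ R → lookup (eR R) (p ↑ʳ F.zero) ≡ false
    lookR-M R = VP.lookup-++ʳ (replicate p false) (false ∷ R) F.zero
    lookR-R : ∀ R (k : Fin q) → lookup (eR R) (p ↑ʳ F.suc k) ≡ lookup R k
    lookR-R R k = VP.lookup-++ʳ (replicate p false) (false ∷ R) (F.suc k)

    EL : Segment p m
    EL = record
      { ι = ιL ; offset = 0 ; toℕ-ι = toℕL ; img = eL ; pre = preL
      ; ∈-img = λ {L} {j} j∈ → look→∈ (trans (lookL-L L j) (∈→look j∈))
      ; ∈-img⁻ = λ {L} {j} j∈ → look→∈ (trans (sym (lookL-L L j)) (∈→look j∈))
      ; img-in-range = λ {L} {x} x∈ → in-range L x (∈→look x∈)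
      ; pre-img = λ L → vec-ext _ _ (λ j → trans (lookup-take p (eL L) j) (lookL-L L j))
      ; img-pre = λ B im → vec-ext _ _ (img-pre-at B im)
      ; img-∪ = λ L L' → trans (cong ((L ∪ L') ++_) (sym (∪-identityˡ _))) (sym (VP.zipWith-++ _∨_ L _ L' _))
      }
      where
      in-range : ∀ L x → lookup (eL L) x ≡ true → ∃[ j ] ιL j ≡ x
      in-range L x h with view x
      ... | vL j = j , refl
      ... | vM = ⊥-elim (t≢f (trans (sym h) (lookL-R L F.zero)))
      ... | vR k = ⊥-elim (t≢f (trans (sym h) (lookL-R L (F.suc k))))
      outside-range : ∀ B → InImage ιL B → ∀ (k : Fin (suc q)) → lookup B (p ↑ʳ k) ≡ false
      outside-range B im k with lookup B (p ↑ʳ k) in eq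
      ... | false = refl
      ... | true = let (j , h) = im _ (look→∈ eq) in ⊥-elim (L≢R j k h)
      img-pre-at : ∀ B → InImage ιL B → ∀ x → lookup (eL (preL B)) x ≡ lookup B x
      img-pre-at B im x with view x
      ... | vL j = trans (lookL-L (preL B) j) (lookup-take p B j)
      ... | vM = trans (lookL-R (preL B) F.zero) (sym (outside-range B im F.zero))
      ... | vR k = trans (lookL-R (preL B) (F.suc k)) (sym (outside-range B im (F.suc k)))

    ER : Segment q m
    ER = record
      { ι = ιR ; offset = suc p ; toℕ-ι = toℕιR ; img = eR ; pre = preR
      ; ∈-img = λ {R} {j} j∈ → look→∈ (trans (lookR-R R j) (∈→look j∈))
      ; ∈-img⁻ = λ {R} {j} j∈ → look→∈ (trans (sym (lookR-R R j)) (∈→look j∈))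
      ; img-in-range = λ {R} {x} x∈ → in-range R x (∈→look x∈)
      ; pre-img = λ R → vec-ext _ _ (λ k → trans (lookup-preR (eR R) k) (lookR-R R k))
      ; img-pre = λ B im → vec-ext _ _ (img-pre-at B im)
      ; img-∪ = λ R R' → trans (cong (_++ (false ∷ (R ∪ R'))) (sym (∪-identityˡ _))) (sym (VP.zipWith-++ _∨_ _ (false ∷ R) _ (false ∷ R')))
      }
      where
      in-range : ∀ R x → lookup (eR R) x ≡ true → ∃[ j ] ιR j ≡ x
      in-range R x h with view x
      ... | vL j = ⊥-elim (t≢f (trans (sym h) (lookR-L R j)))
      ... | vM = ⊥-elim (t≢f (trans (sym h) (lookR-M R)))
      ... | vR k = k , refl
      outside-range : ∀ B → InImage ιR B → ∀ x → (∀ k → ιR k ≡ x → ⊥) → lookup B x ≡ false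
      outside-range B im x nx with lookup B x in eq
      ... | false = refl
      ... | true = let (j , h) = im _ (look→∈ eq) in ⊥-elim (nx j h)
      lookup-preR : ∀ B (k : Fin q) → lookup (preR B) k ≡ lookup B (ιR k)
      lookup-preR B k = trans (lookup-tail (drop p B) k) (lookup-drop p B (F.suc k))
      img-pre-at : ∀ B → InImage ιR B → ∀ x → lookup (eR (preR B)) x ≡ lookup B x
      img-pre-at B im x with view x
      ... | vL j = trans (lookR-L (preR B) j) (sym (outside-range B im _ (λ k h → L≢R j (F.suc k) (sym h))))
      ... | vM = trans (lookR-M (preR B)) (sym (outside-range B im _ (λ k h → R0≢R k (sym h))))
      ... | vR k = trans (lookR-R (preR B) k) (lookup-preR B k)

Supported : ∀ {n} → DiagramData n → Fin n → Set
Supported d x = ∃[ X ] (Blk d X × x ∈ X)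

module MiddleVertex where
  open Segments
  open Restriction
  open PathSplit
  open import Data.Fin.Subset.Properties using (∪-comm)

  walk-visits : ∀ {n} {B : Subset n} {i k} → Walk B i k → i ∈ B →
                ∀ c → toℕ i ≤ c → c ≤ toℕ k → ∃[ z ] (z ∈ B × toℕ z ≡ c)
  walk-visits {i = i} here i∈ c i≤c c≤k = i , i∈ , NP.≤-antisym i≤c c≤k
  walk-visits {i = i} (step {j = j} ad j∈ w) i∈ c i≤c c≤k with toℕ i Data.Nat.≟ c
  ... | yes i≡c = i , i∈ , i≡c
  ... | no  i≢c = walk-visits w j∈ c (next≤ ad) c≤k
    where
    next≤ : Adj i j → toℕ j ≤ c
    next≤ (inj₁ e) = subst (_≤ c) e (NP.≤∧≢⇒< i≤c i≢c)
    next≤ (inj₂ e) = NP.<⇒≤ (NP.<-trans (NP.≤-reflexive e) (NP.≤∧≢⇒< i≤c i≢c))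

  module MiddleParts (p q : ℕ) where
    open ThreeParts p q

    left≤p : ∀ j → toℕ (ιL j) ≤ p
    left≤p j = NP.<⇒≤ (left<p j)

    module _ (D : DiagramData m) (S : IsStaircase D) (gap : ∀ x → toℕ x ≡ p → ¬ Supported D x) where
      open IsStaircase S

      no-walk-across : ∀ {Z x y} → (∀ z → z ∈ Z → Supported D z) → Walk Z x y → x ∈ Z →
                       toℕ x ≤ p → p ≤ toℕ y → ⊥
      no-walk-across supported w x∈ x≤p p≤y with walk-visits w x∈ p x≤p p≤y
      ... | z , z∈ , z≡p = gap z z≡p (supported z z∈)

      side : ∀ X → Blk D X → InImage ιL X ⊎ InImage ιR X
      side X b with nonempty X b
      ... | x₀ , x₀∈ with view x₀
      ... | vM   = ⊥-elim (gap mid toℕ-mid (X , b , x₀∈))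
      ... | vL j = inj₁ left
        where
        left : InImage ιL X
        left y y∈ with view y
        ... | vL j' = j' , refl
        ... | vM    = ⊥-elim (gap mid toℕ-mid (X , b , y∈))
        ... | vR k  = ⊥-elim (no-walk-across (λ z z∈ → X , b , z∈) (connected X b _ _ x₀∈ y∈) x₀∈
                                             (left≤p j) (NP.<⇒≤ (p<right k)))
      ... | vR k = inj₂ right
        where
        right : InImage ιR X
        right y y∈ with view y
        ... | vR k' = k' , refl
        ... | vM    = ⊥-elim (gap mid toℕ-mid (X , b , y∈))
        ... | vL j  = ⊥-elim (no-walk-across (λ z z∈ → X , b , z∈) (connected X b _ _ y∈ x₀∈) y∈
                                             (left≤p j) (NP.<⇒≤ (p<right k)))

      left-right-disconnected : ∀ X Y → Blk D X → Blk D Y → InImage ιL X → InImage ιR Y → Connected (Y ∪ X) → ⊥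
      left-right-disconnected X Y bX bY left right connected-∪ with nonempty X bX | nonempty Y bY
      ... | x , x∈ | y , y∈ with left x x∈ | right y y∈
      ... | j , refl | k , refl =
        no-walk-across supported (connected-∪ _ _ (x∈p∪q⁺ (inj₂ x∈)) (x∈p∪q⁺ (inj₁ y∈))) (x∈p∪q⁺ (inj₂ x∈))
                       (left≤p j) (NP.<⇒≤ (p<right k))
        where
        supported : ∀ z → z ∈ Y ∪ X → Supported D z
        supported z z∈ with x∈p∪q⁻ Y X z∈
        ... | inj₁ z∈Y = Y , bY , z∈Y
        ... | inj₂ z∈X = X , bX , z∈X

      up-closedL : ∀ X Y → _≼_ D X Y → InImage ιL X → InImage ιL Y
      up-closedL = CoverChains.≼-preserves D S (InImage ιL) (InImage ιR) side left-right-disconnected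

      up-closedR : ∀ X Y → _≼_ D X Y → InImage ιR X → InImage ιR Y
      up-closedR = CoverChains.≼-preserves D S (InImage ιR) (InImage ιL) (λ X b → swap (side X b))
        (λ X Y bX bY right left c → left-right-disconnected Y X bY bX left right (subst Connected (∪-comm Y X) c))

      restrictL-staircase : IsStaircase (restrict EL D)
      restrictL-staircase = restrict-staircase EL D S up-closedL

      restrictR-staircase : IsStaircase (restrict ER D)
      restrictR-staircase = restrict-staircase ER D S up-closedR

      restrictR-full : (∀ x → suc p ≤ toℕ x → Supported D x) → FullySupported (restrict ER D)
      restrictR-full supported k with supported (ιR k) (p<right k)
      ... | X , bX , k∈ with side X bX
      ... | inj₁ left  = ⊥-elim (let (j , h) = left _ k∈ in L≢R j (F.suc k) h)
      ... | inj₂ right = preR X , subst (Blk D) (sym (Segment.img-pre ER X right)) bX ,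
                         Segment.∈-img⁻ ER (subst (ιR k ∈_) (sym (Segment.img-pre ER X right)) k∈)

module Decomposition where
  open import Data.Fin.Subset.Properties using (anySubset?; _∈?_)
  open import Relation.Nullary.Decidable using (T?; _×-dec_)
  import Relation.Binary.Construct.On as On
  open import Data.Sum.Relation.Binary.Pointwise as ⊎ using (⊎-setoid)
  open import Data.Product.Relation.Binary.Pointwise.NonDependent using (×-setoid)
  open Segments
  open Restriction
  open PathSplit
  open MiddleVertex

  supported? : ∀ {n} (d : DiagramData n) x → Dec (Supported d x)
  supported? d x = anySubset? (λ X → T? (DiagramData.mem d X) ×-dec (x ∈? X))

  supported-resp : ∀ {n} {d d' : DiagramData n} → (∀ B → DiagramData.mem d B ≡ DiagramData.mem d' B) →
                   ∀ x → Supported d x → Supported d' x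
  supported-resp e x (X , bX , x∈) = X , subst T (e X) bX , x∈

  SupportedFrom : ∀ {m} → ℕ → DiagramData m → Set
  SupportedFrom p d = ∀ x → p ≤ toℕ x → Supported d x

  Gap : ∀ {m} → ℕ → DiagramData m → Set
  Gap p d = ∀ x → toℕ x ≡ p → ¬ Supported d x

  W : ℕ → ℕ → Setoid 0ℓ 0ℓ
  W m p = On.setoid (StaircaseDiagrams m) (proj₁ {B = λ D → SupportedFrom p (proj₁ D)})

  U : ℕ → ℕ → Setoid 0ℓ 0ℓ
  U m p = On.setoid (StaircaseDiagrams m) (proj₁ {B = λ D → SupportedFrom (suc p) (proj₁ D) × Gap p (proj₁ D)})

  full≅W₀ : ∀ m → Inverse (FullStaircaseDiagrams m) (W m 0)
  full≅W₀ m = record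
    { to        = λ { (d , S , full) → (d , S) , (λ x _ → full x) }
    ; from      = λ { ((d , S) , supp) → d , S , (λ x → supp x z≤n) }
    ; to-cong   = λ e → e
    ; from-cong = λ e → e
    ; inverse   = (λ e → e) , (λ e → e) }

  Wₘ≅all : ∀ m → Inverse (W m m) (StaircaseDiagrams m)
  Wₘ≅all m = record
    { to        = proj₁
    ; from      = λ D → D , (λ x m≤x → ⊥-elim (NP.<⇒≱ (FP.toℕ<n x) m≤x))
    ; to-cong   = λ e → e
    ; from-cong = λ e → e
    ; inverse   = (λ e → e) , (λ e → e) }

  module ExtendSupport (m p : ℕ) (p<m : p < m) where
    vertex-p : Fin m
    vertex-p = fromℕ< p<m

    toℕ-vertex-p : toℕ vertex-p ≡ p
    toℕ-vertex-p = FP.toℕ-fromℕ< p<m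

    Split : Setoid 0ℓ 0ℓ
    Split = ⊎-setoid (W m p) (U m p)

    classify : ∀ D → SupportedFrom (suc p) (proj₁ D) → Dec (Supported (proj₁ D) vertex-p) → Setoid.Carrier Split
    classify D supp (yes supp-p) = inj₁ (D , supp′)
      where
      supp′ : SupportedFrom p (proj₁ D)
      supp′ x p≤x with NP.m≤n⇒m<n∨m≡n p≤x
      ... | inj₁ p<x = supp x p<x
      ... | inj₂ p≡x = subst (Supported (proj₁ D)) (FP.toℕ-injective (trans toℕ-vertex-p p≡x)) supp-p
    classify D supp (no gap) =
      inj₂ (D , supp , λ x x≡p sx → gap (subst (Supported (proj₁ D)) (FP.toℕ-injective (trans x≡p (sym toℕ-vertex-p))) sx))

    to : Setoid.Carrier (W m (suc p)) → Setoid.Carrier Split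
    to (D , supp) = classify D supp (supported? (proj₁ D) vertex-p)

    from : Setoid.Carrier Split → Setoid.Carrier (W m (suc p))
    from (inj₁ (D , supp))     = D , λ x p<x → supp x (NP.<⇒≤ p<x)
    from (inj₂ (D , supp , _)) = D , supp

    inv : Inverse (W m (suc p)) Split
    inv = record
      { to = to ; from = from ; to-cong = to-cong
      ; from-cong = λ { (⊎.inj₁ e) → e ; (⊎.inj₂ e) → e }
      ; inverse = inverseˡ , inverseʳ }
      where
      to-cong : ∀ {w w'} → Setoid._≈_ (W m (suc p)) w w' → Setoid._≈_ Split (to w) (to w')
      to-cong {(D , _)} {(D' , _)} e with supported? (proj₁ D) vertex-p | supported? (proj₁ D') vertex-p
      ... | yes _ | yes _  = ⊎.inj₁ e
      ... | no _  | no _   = ⊎.inj₂ e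
      ... | yes s | no ¬s' = ⊥-elim (¬s' (supported-resp {d = proj₁ D} {proj₁ D'} (proj₁ e) vertex-p s))
      ... | no ¬s | yes s' = ⊥-elim (¬s (supported-resp {d = proj₁ D'} {proj₁ D} (λ B → sym (proj₁ e B)) vertex-p s'))
      inverseˡ : ∀ {x y} → Setoid._≈_ (W m (suc p)) y (from x) → Setoid._≈_ Split (to y) x
      inverseˡ {inj₁ (D , supp)} {(D' , _)} e with supported? (proj₁ D') vertex-p
      ... | yes _ = ⊎.inj₁ e
      ... | no ¬s = ⊥-elim (¬s (supported-resp {d = proj₁ D} {proj₁ D'} (λ B → sym (proj₁ e B)) vertex-p (supp vertex-p (NP.≤-reflexive (sym toℕ-vertex-p)))))
      inverseˡ {inj₂ (D , _ , gap)} {(D' , _)} e with supported? (proj₁ D') vertex-p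
      ... | yes s = ⊥-elim (gap vertex-p toℕ-vertex-p (supported-resp {d = proj₁ D'} {proj₁ D} (proj₁ e) vertex-p s))
      ... | no _  = ⊎.inj₂ e
      inverseʳ : ∀ {x y} → Setoid._≈_ Split y (to x) → Setoid._≈_ (W m (suc p)) (from y) x
      inverseʳ {(D , _)} {y} e with supported? (proj₁ D) vertex-p
      inverseʳ {(D , _)} {inj₁ _} (⊎.inj₁ e) | yes _ = e
      inverseʳ {(D , _)} {inj₂ _} (⊎.inj₂ e) | no _  = e

  module SplitAtGap (p q : ℕ) where
    open ThreeParts p q
    open MiddleParts p q
    open Join EL ER L-R-disjoint L-R-nonadjacent

    Sides : Setoid 0ℓ 0ℓ
    Sides = ×-setoid (StaircaseDiagrams p) (FullStaircaseDiagrams q)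

    to : Setoid.Carrier (U m p) → Setoid.Carrier Sides
    to ((D , S) , (supp , gap)) =
      (restrict EL D , restrictL-staircase D S gap) , (restrict ER D , restrictR-staircase D S gap , restrictR-full D S gap supp)

    glue-supported : ∀ d1 d2 → FullySupported d2 → SupportedFrom (suc p) (glue d1 d2)
    glue-supported d1 d2 full x p<x with view x
    ... | vL j = ⊥-elim (NP.<-asym (left<p j) p<x)
    ... | vM   = ⊥-elim (NP.<-irrefl (sym toℕ-mid) p<x)
    ... | vR k with full k
    ...   | R , bR , k∈ = eR R , glue-block₂ d1 d2 bR , Segment.∈-img ER k∈

    glue-gap : ∀ d1 d2 → Gap p (glue d1 d2)
    glue-gap d1 d2 x x≡p (X , bX , x∈) with glue-block⁻ d1 d2 X bX
    ... | inj₁ (L , refl , _) with Segment.img-in-range EL x∈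
    ...   | j , refl = NP.<-irrefl x≡p (left<p j)
    glue-gap d1 d2 x x≡p (X , bX , x∈) | inj₂ (R , refl , _) with Segment.img-in-range ER x∈
    ...   | k , refl = NP.<-irrefl (sym x≡p) (p<right k)

    from : Setoid.Carrier Sides → Setoid.Carrier (U m p)
    from ((d1 , S1) , (d2 , S2 , full)) = (glue d1 d2 , glue-staircase d1 d2 S1 S2) , (glue-supported d1 d2 full , glue-gap d1 d2)

    inv : Inverse (U m p) Sides
    inv = record
      { to = to ; from = from
      ; to-cong = λ { (mem≡ , ord≡) → ((λ L → mem≡ (eL L)) , (λ L L' → ord≡ (eL L) (eL L'))) ,
                                      ((λ R → mem≡ (eR R)) , (λ R R' → ord≡ (eR R) (eR R'))) }
      ; from-cong = λ { {((d1 , _) , (d2 , _))} {((d1' , _) , (d2' , _))} ((mem≡₁ , ord≡₁) , (mem≡₂ , ord≡₂)) →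
                          glue-cong-mem {d1} {d1'} {d2} {d2'} mem≡₁ mem≡₂ , glue-cong-ord {d1} {d1'} {d2} {d2'} ord≡₁ ord≡₂ }
      ; inverse = (λ {x} {y} → inverseˡ {x} {y}) , (λ {x} {y} → inverseʳ {x} {y}) }
      where
      inverseˡ : ∀ {x y} → Setoid._≈_ (U m p) y (from x) → Setoid._≈_ Sides (to y) x
      inverseˡ {((d1 , S1) , (d2 , S2 , _))} (mem≡ , ord≡) =
        ((λ L → trans (mem≡ (eL L)) (restrict₁-glue-mem d1 d2 S1 S2 L)) ,
         (λ L L' → trans (ord≡ (eL L) (eL L')) (restrict₁-glue-ord d1 d2 S1 S2 L L'))) ,
        ((λ R → trans (mem≡ (eR R)) (restrict₂-glue-mem d1 d2 S1 S2 R)) ,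
         (λ R R' → trans (ord≡ (eR R) (eR R')) (restrict₂-glue-ord d1 d2 S1 S2 R R')))
      inverseʳ : ∀ {x y} → Setoid._≈_ Sides y (to x) → Setoid._≈_ (U m p) (from y) x
      inverseʳ {((D , S) , (_ , gap))} {((d1 , _) , (d2 , _))} ((mem≡₁ , ord≡₁) , (mem≡₂ , ord≡₂)) =
        (λ X → trans (glue-cong-mem {d1} {restrict EL D} {d2} {restrict ER D} mem≡₁ mem≡₂ X)
                     (glue-restrict-mem D S (side D S gap) (up-closedL D S gap) (up-closedR D S gap) X)) ,
        (λ X Y → trans (glue-cong-ord {d1} {restrict EL D} {d2} {restrict ER D} ord≡₁ ord≡₂ X Y)
                       (glue-restrict-ord D S (side D S gap) (up-closedL D S gap) (up-closedR D S gap) X Y))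

module EmptyPath where
  open Cardinality

  empty : DiagramData 0
  empty = record { mem = λ _ → false ; ord = λ _ _ → false }

  empty-staircase : IsStaircase empty
  empty-staircase = record
    { ord-dom = λ _ _ () ; ≼-refl = λ _ () ; ≼-antisym = λ _ _ () ; ≼-trans = λ _ _ _ ()
    ; nonempty = λ _ () ; connected = λ _ () ; cover-connected = λ { _ _ (() , _) }
    ; chain = λ () ; adj-chain = λ () ; adj-saturated = λ () ; is-min = λ _ () ; is-max = λ _ () }

  -- A_0 has no nonempty vertex set, hence no blocks
  only-empty : ∀ (d : DiagramData 0) → IsStaircase d →
               (∀ B → false ≡ DiagramData.mem d B) × (∀ B C → false ≡ DiagramData.ord d B C)
  only-empty d S =
    (λ { [] → sym (¬T⇒false λ b → no-vertex (IsStaircase.nonempty S [] b)) }) ,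
    (λ { [] [] → sym (¬T⇒false λ b → no-vertex (IsStaircase.nonempty S [] (proj₁ (IsStaircase.ord-dom S [] [] b)))) })
    where
    no-vertex : ∀ {B} → Nonempty {0} B → ⊥
    no-vertex (() , _)
    ¬T⇒false : ∀ {b} → ¬ T b → b ≡ false
    ¬T⇒false {false} _ = refl
    ¬T⇒false {true}  f = ⊥-elim (f tt)

  fin1-unique : ∀ (x y : Fin 1) → x ≡ y
  fin1-unique F.zero F.zero = refl

  size-all₀ : HasSize (StaircaseDiagrams 0) 1
  size-all₀ = record
    { to = λ _ → empty , empty-staircase ; from = λ _ → F.zero
    ; to-cong = λ _ → (λ _ → refl) , (λ _ _ → refl) ; from-cong = λ _ → refl
    ; inverse = (λ { {(d , S)} _ → only-empty d S }) , (λ _ → fin1-unique _ _) }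

  size-full₀ : HasSize (FullStaircaseDiagrams 0) 1
  size-full₀ = record
    { to = λ _ → empty , empty-staircase , (λ ()) ; from = λ _ → F.zero
    ; to-cong = λ _ → (λ _ → refl) , (λ _ _ → refl) ; from-cong = λ _ → refl
    ; inverse = (λ { {(d , S , _)} _ → only-empty d S }) , (λ _ → fin1-unique _ _) }

-- Counting W m p by induction on p: W m 0 are the fully supported diagrams,
-- each step adds U m p ≅ (all diagrams on A_p) × (full diagrams on A_{m-1-p}),
-- and W m m are all diagrams.  Hence a_m = ā_m + Σ_{p<m} a_p ā_{m-1-p}.
module Counting (a ā : ℕ → ℕ)
  (size-a : ∀ n → Cardinality.HasSize (StaircaseDiagrams n) (a n))
  (size-ā : ∀ n → Cardinality.HasSize (FullStaircaseDiagrams n) (ā n)) where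
  open import Data.Nat using (_+_; _*_)
  import Function.Construct.Symmetry as Symmetry
  open Cardinality
  open Decomposition

  w : ℕ → ℕ → ℕ
  w m zero    = ā m
  w m (suc p) = w m p + a p * ā (m ∸ suc p)

  size-U : ∀ m p → p < m → HasSize (U m p) (a p * ā (m ∸ suc p))
  size-U m p p<m = split (m ∸ suc p) m (trans (NP.+-suc p (m ∸ suc p)) (NP.m+[n∸m]≡n p<m))
    where
    split : ∀ q m → p + suc q ≡ m → HasSize (U m p) (a p * ā q)
    split q .(p + suc q) refl = size-transport (size-× (size-a p) (size-ā q)) (Symmetry.inverse (SplitAtGap.inv p q))

  size-W : ∀ m p → p ≤ m → HasSize (W m p) (w m p)
  size-W m zero    _   = size-transport (size-ā m) (full≅W₀ m)
  size-W m (suc p) p<m = size-transport (size-⊎ (size-W m p (NP.<⇒≤ p<m)) (size-U m p p<m))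
                                       (Symmetry.inverse (ExtendSupport.inv m p p<m))

  a≡w : ∀ m → a m ≡ w m m
  a≡w m = size-unique (size-a m) (size-transport (size-W m m NP.≤-refl) (Wₘ≅all m))

  a₀ : a 0 ≡ 1
  a₀ = size-unique (size-a 0) EmptyPath.size-all₀

  ā₀ : ā 0 ≡ 1
  ā₀ = size-unique (size-ā 0) EmptyPath.size-full₀

module Recurrence (a ā : ℕ → ℕ)
  (size-a : ∀ n → Cardinality.HasSize (StaircaseDiagrams n) (a n))
  (size-ā : ∀ n → Cardinality.HasSize (FullStaircaseDiagrams n) (ā n)) where
  open import Data.Integer using (+_; _+_; _*_)
  import Data.Integer.Properties as ZP
  open PowerSeries
  open Counting a ā size-a size-ā

  w-as-sum : ∀ m p → + w m p ≡ + ā m + Σ< p (λ i → + a i * + ā (m ∸ suc i))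
  w-as-sum m zero    = sym (ZP.+-identityʳ (+ ā m))
  w-as-sum m (suc p) = begin
    + (w m p Data.Nat.+ a p Data.Nat.* ā (m ∸ suc p))          ≡⟨ ZP.pos-+ (w m p) _ ⟩
    + w m p + + (a p Data.Nat.* ā (m ∸ suc p))                 ≡⟨ cong₂ _+_ (w-as-sum m p) (ZP.pos-* (a p) _) ⟩
    (+ ā m + Σ< p f) + f p                                     ≡⟨ ZP.+-assoc (+ ā m) (Σ< p f) (f p) ⟩
    + ā m + (Σ< p f + f p)                                     ≡⟨ cong (λ x → + ā m + x) (Σ<-suc p f) ⟨
    + ā m + Σ< (suc p) f                                       ∎
    where
    open ≡-Reasoning
    f : ℕ → _
    f i = + a i * + ā (m ∸ suc i)

  recurrence : ∀ m → genFun a (suc m) ≡ genFun ā (suc m) + (genFun a ⊛ genFun ā) m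
  recurrence m = begin
    + a (suc m)                                                   ≡⟨ cong +_ (a≡w (suc m)) ⟩
    + w (suc m) (suc m)                                           ≡⟨ w-as-sum (suc m) (suc m) ⟩
    + ā (suc m) + Σ< (suc m) (λ i → + a i * + ā (m ∸ i))          ≡⟨ cong (λ x → + ā (suc m) + x) (⊛-as-Σ< (genFun a) (genFun ā) m) ⟨
    + ā (suc m) + (genFun a ⊛ genFun ā) m                          ∎
    where open ≡-Reasoning

open PowerSeries using (⊛-congʳ; denominator; recurrence⇒identity; positivePart; positivePart-genFun)
open Counting using (a₀; ā₀)
open Recurrence using (recurrence)
import Data.Integer as ℤ

theorem8p4 : (a a̅ : ℕ → ℕ) →
    (∀ n → Inverse (setoid (Fin (a n))) (StaircaseDiagrams n)) →
    (∀ n → Inverse (setoid (Fin (a̅ n))) (FullStaircaseDiagrams n)) →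
    ∀ m → (genFun a ⊛ ((𝟙 ⊖ 𝕥) ⊖ (𝕥 ⊛ genFun₊ a̅))) m
          ≡ (𝟙 ⊕ genFun₊ a̅) m
theorem8p4 a ā size-a size-ā m = begin
  (genFun a ⊛ ((𝟙 ⊖ 𝕥) ⊖ (𝕥 ⊛ genFun₊ ā))) m   ≡⟨ ⊛-congʳ (genFun a) (denominator ā (ā₀ a ā size-a size-ā)) m ⟩
  (genFun a ⊛ (𝟙 ⊖ (𝕥 ⊛ genFun ā))) m          ≡⟨ recurrence⇒identity (genFun a) (genFun ā) (cong ℤ.+_ (a₀ a ā size-a size-ā))
                                                                         (recurrence a ā size-a size-ā) m ⟩
  (𝟙 ⊕ positivePart (genFun ā)) m               ≡⟨ cong (ℤ._+_ (𝟙 m)) (positivePart-genFun ā m) ⟩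
  (𝟙 ⊕ genFun₊ ā) m                             ∎
  where open ≡-Reasoning
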